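{- The Ehrhart polynomial for $P = P_n(123,132,312)$ is $(1+m)^{n-1}$ and so the $h^*$-polynomial of $P$ is the Eulerian polynomial $A_{n-1}(t)$.
   Context: $P_n(123,132,312)=\operatorname{conv}\{(a_1,\dots,a_n)\in\mathbb{R}^n : a_1\cdots a_n\in\mathfrak{S}_n$ avoids each of the patterns $123$, $132$, $312\}$. The $h^*$-polynomial $h^*_P(t)$ is the numerator when the Ehrhart series $1+\sum_{m\ge1}|mP\cap\mathbb{Z}^n|t^m$ is written as $h^*_P(t)/(1-t)^{\dim P+1}$. -}

module Defs where

open import Data.Nat as ℕ using (ℕ; zero; suc; _<ᵇ_; _∸_)
open import Data.Bool using (if_then_else_)
open import Data.Integer as ℤ using (ℤ; +_)
open import Data.Rational as ℚ using (ℚ; 0ℚ; _/_)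
open import Data.Fin as Fin using (Fin)
open import Data.Vec as Vec using (Vec; lookup; toList)
open import Data.List as List using (List; []; _∷_; map; upTo; length)
open import Data.List.Relation.Unary.All using (All)
open import Data.List.Relation.Unary.Unique.Propositional using (Unique)
open import Data.List.Membership.Propositional using (_∈_)
open import Data.List.Relation.Binary.Permutation.Propositional using (_↭_)
open import Data.Product using (Σ; _×_; _,_; ∃)
open import Relation.Binary.PropositionalEquality using (_≡_)
open import Relation.Nullary using (¬_)
open import Function.Bundles using (_⇔_)

IsPerm : (n : ℕ) → Vec ℕ n → Set
IsPerm n a = toList a ↭ map suc (upTo n)

Avoids123 Avoids132 Avoids312 : (n : ℕ) → Vec ℕ n → Set
Avoids123 n a = ∀ (i j k : Fin n) → i Fin.< j → j Fin.< k →
  ¬ (lookup a i ℕ.< lookup a j × lookup a j ℕ.< lookup a k)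
Avoids132 n a = ∀ (i j k : Fin n) → i Fin.< j → j Fin.< k →
  ¬ (lookup a i ℕ.< lookup a k × lookup a k ℕ.< lookup a j)
Avoids312 n a = ∀ (i j k : Fin n) → i Fin.< j → j Fin.< k →
  ¬ (lookup a j ℕ.< lookup a k × lookup a k ℕ.< lookup a i)

-- the points (a₁,…,aₙ) whose convex hull is P_n(123,132,312)
IsVertex : (n : ℕ) → Vec ℕ n → Set
IsVertex n a = IsPerm n a × Avoids123 n a × Avoids132 n a × Avoids312 n a

ℕtoℚ : ℕ → ℚ
ℕtoℚ k = (+ k) / 1

ℤtoℚ : ℤ → ℚ
ℤtoℚ z = z / 1

sumℚ : List ℚ → ℚ
sumℚ = List.foldr ℚ._+_ 0ℚ

-- x ∈ m·P, where P = conv{vertices}: x is a combination Σ λ_j v_j of vertices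
-- v_j with rational λ_j ≥ 0 and Σ λ_j = m.
InDilate : (n : ℕ) → (m : ℕ) → Vec ℤ n → Set
InDilate n m x =
  Σ (List (ℚ × Vec ℕ n)) λ cs →
    All (λ c → (0ℚ ℚ.≤ Data.Product.proj₁ c) × IsVertex n (Data.Product.proj₂ c)) cs
    × sumℚ (map Data.Product.proj₁ cs) ≡ ℕtoℚ m
    × (∀ (i : Fin n) →
         sumℚ (map (λ c → Data.Product.proj₁ c ℚ.* ℕtoℚ (lookup (Data.Product.proj₂ c) i)) cs)
           ≡ ℤtoℚ (lookup x i))

LatticeCount : (n m N : ℕ) → Set
LatticeCount n m N =
  Σ (List (Vec ℤ n)) λ xs →
    Unique xs × (∀ x → (x ∈ xs) ⇔ InDilate n m x) × length xs ≡ N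

des : List ℕ → ℕ
des [] = 0
des (x ∷ []) = 0
des (x ∷ y ∷ ys) = (if y <ᵇ x then 1 else 0) ℕ.+ des (y ∷ ys)

-- Eulerian number: N = #{σ ∈ 𝔖_k : des σ = j}, the coefficient of t^j in
-- A_k(t) = Σ_{σ ∈ 𝔖_k} t^{des σ}
EulerianCount : (k j N : ℕ) → Set
EulerianCount k j N =
  Σ (List (Vec ℕ k)) λ σs →
    Unique σs × (∀ σ → (σ ∈ σs) ⇔ (IsPerm k σ × des (toList σ) ≡ j)) × length σs ≡ N

-- The vertices of P = P_{k+1}(123,132,312) are the k+1 permutations (k, k-1, …, k-p+1, k+1, k-p, …, 1).
-- Write Λ_t(x) = x_0 + ⋯ + x_{t-1} - m (k + (k-1) + ⋯ + (k-t+1)).  The vertex with its maximum at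
-- position p has Λ_t = t [p < t], so x lies in mP exactly when the ratios Λ_t / t form a lecture hall
-- sequence 0 ≤ Λ_1/1 ≤ Λ_2/2 ≤ ⋯ ≤ Λ_{k+1}/(k+1) = m; the weights of x as a convex combination of
-- vertices are the increments of that sequence.  Since x ↦ (Λ_1, …, Λ_k) is unimodular, the lattice
-- points of mP correspond to integral lecture hall sequences, and splitting these according to the
-- bound on their last entry gives the count (1+m)^k.  The h*-statement is Worpitzky's identity
-- Σ_{σ ∈ 𝔖_k} C(m + k - des σ, k) = (1+m)^k, proved by inserting the largest letter into the
-- permutations of 𝔖_{k-1}.

module Submission where

open import Defs
open import Algebra.Bundles using (AbelianGroup)
import Algebra.Properties.Group as GroupProperties
open import Data.Bool using (true; false; if_then_else_)
open import Data.Bool.Properties using (T-≡; ¬-not)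
open import Data.Empty using (⊥-elim)
open import Data.Fin as Fin using (Fin; toℕ; fromℕ<)
open import Data.Fin.Properties using (toℕ<n; toℕ-fromℕ<; toℕ-injective)
import Data.Fin.Properties as Fin
open import Data.Integer as ℤ using (ℤ; +_; 0ℤ; +≤+)
import Data.Integer.Properties as ℤ
import Data.Integer.Tactic.RingSolver as ℤ-Solver
open import Data.List as List
  using (List; []; _∷_; _++_; map; upTo; downFrom; applyUpTo; concatMap; filter; length; foldr)
open import Data.List.Properties
  using (map-cong; map-cong-local; map-∘; map-++; map-tabulate; map-upTo; upTo-∷ʳ; length-++; length-map)
open import Data.List.Membership.Propositional using (_∈_; _∉_; find; lose)
open import Data.List.Membership.Propositional.Properties
  using ( ∈-map⁺; ∈-map⁻; ∈-upTo⁺; ∈-upTo⁻; ∈-++⁺ˡ; ∈-++⁺ʳ; ∈-++⁻; ∈-tabulate⁺; ∈-tabulate⁻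
        ; ∈-concatMap⁺; ∈-concatMap⁻; ∈-filter⁺; ∈-filter⁻)
open import Data.List.Membership.Propositional.Properties.WithK using (unique∧set⇒bag)
open import Data.List.Relation.Binary.BagAndSetEquality using (∼bag⇒↭)
open import Data.List.Relation.Binary.Permutation.Propositional
  using (_↭_; ↭-refl; ↭-sym; ↭-trans; ↭-prep; ↭-swap; ↭⇒↭ₛ)
open import Data.List.Relation.Binary.Permutation.Propositional.Properties
  using (∈-resp-↭; drop-∷; ∷↭∷ʳ; ↭-length)
import Data.List.Relation.Binary.Permutation.Setoid.Properties as Permutationₛ
open import Data.List.Relation.Unary.All as All using (All; []; _∷_)
import Data.List.Relation.Unary.All.Properties as All
open import Data.List.Relation.Unary.AllPairs using ([]; _∷_)
open import Data.List.Relation.Unary.Any using (here; there)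
open import Data.List.Relation.Unary.Unique.Propositional using (Unique)
import Data.List.Relation.Unary.Unique.Propositional.Properties as Unique
open import Data.Nat as ℕ
  using (ℕ; zero; suc; _+_; _*_; _∸_; _^_; _<_; _≤_; _<?_; _≟_; _<ᵇ_; _≡ᵇ_; z≤n; s≤s; pred)
open import Data.Nat.Properties
open import Data.Nat.Combinatorics using (_C_; nC1≡n; nCk+nC[k+1]≡[n+1]C[k+1])
open import Data.Nat.Combinatorics.Specification using (k>n⇒nCk≡0)
open import Data.Nat.ListAction using (sum)
open import Data.Nat.ListAction.Properties using (sum-++)
open import Data.Nat.Tactic.RingSolver using (solve-∀)
open import Data.Product using (∃; _×_; _,_; proj₁; proj₂)
open import Data.Rational as ℚ using (ℚ; 0ℚ; _/_; toℚᵘ)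
import Data.Rational.Properties as ℚ
open import Data.Rational.Solver using (module +-*-Solver)
open import Data.Rational.Unnormalised as ℚᵘ using (mkℚᵘ; *≡*; *≤*)
import Data.Rational.Unnormalised.Properties as ℚᵘ
open import Data.Sum using (inj₁; inj₂)
open import Data.Unit using (⊤; tt)
open import Data.Vec as Vec using (Vec; []; _∷_; lookup; tabulate; toList; insertAt; removeAt)
open import Data.Vec.Properties
  using ( lookup∘tabulate; tabulate∘lookup; tabulate-cong; ∷-injective; ∷-injectiveʳ; insertAt-removeAt
        ; length-toList)
import Data.Vec.Membership.Propositional.Properties as Vec
import Data.Vec.Relation.Unary.Any as VecAny
open import Data.Vec.Relation.Unary.Any.Properties using (lookup-index)
open import Function using (id)
open import Function.Bundles using (Equivalence; mk⇔)
open import Relation.Binary using (tri<; tri≈; tri>)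
open import Relation.Binary.PropositionalEquality
open import Relation.Nullary using (¬_; yes; no)

open +-*-Solver using (solve; _:+_; _:-_; _:*_; _:=_)

lookupOr : {A : Set} {n : ℕ} → A → Vec A n → ℕ → A
lookupOr d []       _       = d
lookupOr d (x ∷ xs) zero    = x
lookupOr d (x ∷ xs) (suc i) = lookupOr d xs i

lookupOr-toℕ : ∀ {A : Set} {n} (d : A) (xs : Vec A n) i → lookupOr d xs (toℕ i) ≡ lookup xs i
lookupOr-toℕ d (x ∷ xs) Fin.zero    = refl
lookupOr-toℕ d (x ∷ xs) (Fin.suc i) = lookupOr-toℕ d xs i

lookupOr-fromℕ< : ∀ {A : Set} {n} (d : A) (xs : Vec A n) {i} (i<n : i < n) →
                  lookupOr d xs i ≡ lookup xs (fromℕ< i<n)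
lookupOr-fromℕ< d xs i<n = trans (cong (lookupOr d xs) (sym (toℕ-fromℕ< i<n))) (lookupOr-toℕ d xs _)

lookupOr-tabulate : ∀ {A : Set} {n} (d : A) (f : ℕ → A) {i} → i < n →
                    lookupOr d (tabulate {n = n} (λ j → f (toℕ j))) i ≡ f i
lookupOr-tabulate d f i<n = trans (lookupOr-fromℕ< d (tabulate (λ j → f (toℕ j))) i<n)
  (trans (lookup∘tabulate (λ j → f (toℕ j)) (fromℕ< i<n)) (cong f (toℕ-fromℕ< i<n)))

lookupOr-length : ∀ {A : Set} {n} (d : A) (xs : Vec A n) → lookupOr d xs n ≡ d
lookupOr-length d []       = refl
lookupOr-length d (x ∷ xs) = lookupOr-length d xs

lookupOr-extensional : ∀ {A : Set} {n} (d : A) (xs ys : Vec A n) →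
                       (∀ i → i < n → lookupOr d xs i ≡ lookupOr d ys i) → xs ≡ ys
lookupOr-extensional d []       []       _  = refl
lookupOr-extensional d (x ∷ xs) (y ∷ ys) eq =
  cong₂ _∷_ (eq 0 (s≤s z≤n)) (lookupOr-extensional d xs ys (λ i i<n → eq (suc i) (s≤s i<n)))

toℚᵘ-ℤtoℚ : ∀ z → toℚᵘ (ℤtoℚ z) ℚᵘ.≃ mkℚᵘ z 0
toℚᵘ-ℤtoℚ z = ℚ.toℚᵘ-fromℚᵘ (mkℚᵘ z 0)

ℤtoℚ-+ : ∀ a b → ℤtoℚ (a ℤ.+ b) ≡ ℤtoℚ a ℚ.+ ℤtoℚ b
ℤtoℚ-+ a b = ℚ.toℚᵘ-injective (begin
  toℚᵘ (ℤtoℚ (a ℤ.+ b))             ≈⟨ toℚᵘ-ℤtoℚ (a ℤ.+ b) ⟩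
  mkℚᵘ (a ℤ.+ b) 0                   ≈⟨ *≡* (denominator-1 a b) ⟩
  mkℚᵘ a 0 ℚᵘ.+ mkℚᵘ b 0             ≈⟨ ℚᵘ.+-cong (toℚᵘ-ℤtoℚ a) (toℚᵘ-ℤtoℚ b) ⟨
  toℚᵘ (ℤtoℚ a) ℚᵘ.+ toℚᵘ (ℤtoℚ b)   ≈⟨ ℚ.toℚᵘ-homo-+ (ℤtoℚ a) (ℤtoℚ b) ⟨
  toℚᵘ (ℤtoℚ a ℚ.+ ℤtoℚ b)           ∎)
  where
  open ℚᵘ.≃-Reasoning
  denominator-1 : ∀ a b → (a ℤ.+ b) ℤ.* + 1 ≡ (a ℤ.* + 1 ℤ.+ b ℤ.* + 1) ℤ.* + 1
  denominator-1 = ℤ-Solver.solve-∀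

ℤtoℚ-* : ∀ a b → ℤtoℚ (a ℤ.* b) ≡ ℤtoℚ a ℚ.* ℤtoℚ b
ℤtoℚ-* a b = ℚ.toℚᵘ-injective (begin
  toℚᵘ (ℤtoℚ (a ℤ.* b))             ≈⟨ toℚᵘ-ℤtoℚ (a ℤ.* b) ⟩
  mkℚᵘ a 0 ℚᵘ.* mkℚᵘ b 0             ≈⟨ ℚᵘ.*-cong (toℚᵘ-ℤtoℚ a) (toℚᵘ-ℤtoℚ b) ⟨
  toℚᵘ (ℤtoℚ a) ℚᵘ.* toℚᵘ (ℤtoℚ b)   ≈⟨ ℚ.toℚᵘ-homo-* (ℤtoℚ a) (ℤtoℚ b) ⟨
  toℚᵘ (ℤtoℚ a ℚ.* ℤtoℚ b)           ∎)
  where open ℚᵘ.≃-Reasoning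

ℤtoℚ-neg : ∀ a → ℤtoℚ (ℤ.- a) ≡ ℚ.- ℤtoℚ a
ℤtoℚ-neg a = ℚ.toℚᵘ-injective (begin
  toℚᵘ (ℤtoℚ (ℤ.- a))    ≈⟨ toℚᵘ-ℤtoℚ (ℤ.- a) ⟩
  ℚᵘ.- mkℚᵘ a 0           ≈⟨ ℚᵘ.-‿cong (toℚᵘ-ℤtoℚ a) ⟨
  ℚᵘ.- toℚᵘ (ℤtoℚ a)      ≈⟨ ℚ.toℚᵘ-homo‿- (ℤtoℚ a) ⟨
  toℚᵘ (ℚ.- ℤtoℚ a)       ∎)
  where open ℚᵘ.≃-Reasoning

ℤtoℚ-minus : ∀ a b → ℤtoℚ (a ℤ.- b) ≡ ℤtoℚ a ℚ.- ℤtoℚ b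
ℤtoℚ-minus a b = trans (ℤtoℚ-+ a (ℤ.- b)) (cong (ℤtoℚ a ℚ.+_) (ℤtoℚ-neg b))

ℕtoℚ-+ : ∀ a b → ℕtoℚ (a ℕ.+ b) ≡ ℕtoℚ a ℚ.+ ℕtoℚ b
ℕtoℚ-+ a b = ℤtoℚ-+ (+ a) (+ b)

ℕtoℚ-* : ∀ a b → ℕtoℚ (a ℕ.* b) ≡ ℕtoℚ a ℚ.* ℕtoℚ b
ℕtoℚ-* a b = trans (cong ℤtoℚ (ℤ.pos-* a b)) (ℤtoℚ-* (+ a) (+ b))

ℤtoℚ-injective : ∀ {a b} → ℤtoℚ a ≡ ℤtoℚ b → a ≡ b
ℤtoℚ-injective {a} {b} eq
  with ℚᵘ.≃-trans (ℚᵘ.≃-sym (toℚᵘ-ℤtoℚ a)) (ℚᵘ.≃-trans (ℚ.toℚᵘ-cong eq) (toℚᵘ-ℤtoℚ b))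
... | *≡* a*1≡b*1 = trans (sym (ℤ.*-identityʳ a)) (trans a*1≡b*1 (ℤ.*-identityʳ b))

ℤtoℚ-mono-≤ : ∀ {a b} → a ℤ.≤ b → ℤtoℚ a ℚ.≤ ℤtoℚ b
ℤtoℚ-mono-≤ {a} {b} a≤b = ℚ.toℚᵘ-cancel-≤ (ℚᵘ.≤-respʳ-≃ (ℚᵘ.≃-sym (toℚᵘ-ℤtoℚ b))
  (ℚᵘ.≤-respˡ-≃ (ℚᵘ.≃-sym (toℚᵘ-ℤtoℚ a)) (*≤* (ℤ.*-monoʳ-≤-nonNeg (+ 1) a≤b))))

ℤtoℚ-cancel-≤ : ∀ {a b} → ℤtoℚ a ℚ.≤ ℤtoℚ b → a ℤ.≤ b
ℤtoℚ-cancel-≤ {a} {b} le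
  with ℚᵘ.≤-respʳ-≃ (toℚᵘ-ℤtoℚ b) (ℚᵘ.≤-respˡ-≃ (toℚᵘ-ℤtoℚ a) (ℚ.toℚᵘ-mono-≤ le))
... | *≤* a*1≤b*1 = subst₂ ℤ._≤_ (ℤ.*-identityʳ a) (ℤ.*-identityʳ b) a*1≤b*1

*-monoˡ-≤-ℕtoℚ : ∀ {q a b} → 0ℚ ℚ.≤ q → a ≤ b → q ℚ.* ℕtoℚ a ℚ.≤ q ℚ.* ℕtoℚ b
*-monoˡ-≤-ℕtoℚ {q} 0≤q a≤b = ℚ.*-monoˡ-≤-nonNeg q {{ℚ.nonNegative 0≤q}} (ℤtoℚ-mono-≤ (+≤+ a≤b))

module _ {A : Set} where

  sumℚ-map-0 : ∀ (xs : List A) → sumℚ (map (λ _ → 0ℚ) xs) ≡ 0ℚ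
  sumℚ-map-0 []       = refl
  sumℚ-map-0 (_ ∷ xs) = cong (0ℚ ℚ.+_) (sumℚ-map-0 xs)

  sumℚ-map-+ : ∀ (f g : A → ℚ) xs →
               sumℚ (map (λ a → f a ℚ.+ g a) xs) ≡ sumℚ (map f xs) ℚ.+ sumℚ (map g xs)
  sumℚ-map-+ f g []       = refl
  sumℚ-map-+ f g (a ∷ xs) = trans (cong (f a ℚ.+ g a ℚ.+_) (sumℚ-map-+ f g xs))
    (solve 4 (λ x y u v → (x :+ y) :+ (u :+ v) := (x :+ u) :+ (y :+ v)) refl
      (f a) (g a) (sumℚ (map f xs)) (sumℚ (map g xs)))

  sumℚ-map-*ˡ : ∀ q (f : A → ℚ) xs → sumℚ (map (λ a → q ℚ.* f a) xs) ≡ q ℚ.* sumℚ (map f xs)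
  sumℚ-map-*ˡ q f []       = sym (ℚ.*-zeroʳ q)
  sumℚ-map-*ˡ q f (a ∷ xs) = trans (cong (q ℚ.* f a ℚ.+_) (sumℚ-map-*ˡ q f xs))
    (sym (ℚ.*-distribˡ-+ q (f a) (sumℚ (map f xs))))

  sumℚ-map-mono-≤ : ∀ {f g : A → ℚ} {xs} → All (λ a → f a ℚ.≤ g a) xs →
                    sumℚ (map f xs) ℚ.≤ sumℚ (map g xs)
  sumℚ-map-mono-≤ []       = ℚ.≤-refl
  sumℚ-map-mono-≤ (le ∷ les) = ℚ.+-mono-≤ le (sumℚ-map-mono-≤ les)

sumℚ-swap : ∀ {A B : Set} (f : A → B → ℚ) xs ys →
            sumℚ (map (λ a → sumℚ (map (f a) ys)) xs) ≡
            sumℚ (map (λ b → sumℚ (map (λ a → f a b) xs)) ys)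
sumℚ-swap f []       ys = sym (sumℚ-map-0 ys)
sumℚ-swap f (a ∷ xs) ys = trans (cong (sumℚ (map (f a) ys) ℚ.+_) (sumℚ-swap f xs ys))
  (sym (sumℚ-map-+ (f a) (λ b → sumℚ (map (λ a → f a b) xs)) ys))

sumℤ : List ℤ → ℤ
sumℤ = foldr ℤ._+_ 0ℤ

∑ℕ : ℕ → (ℕ → ℕ) → ℕ
∑ℕ t f = sum (map f (downFrom t))

∑ℤ : ℕ → (ℕ → ℤ) → ℤ
∑ℤ t f = sumℤ (map f (downFrom t))

∑ℚ : ℕ → (ℕ → ℚ) → ℚ
∑ℚ t f = sumℚ (map f (downFrom t))

∑ℕ-cong : ∀ t {f g} → (∀ i → i < t → f i ≡ g i) → ∑ℕ t f ≡ ∑ℕ t g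
∑ℕ-cong zero    eq = refl
∑ℕ-cong (suc t) eq = cong₂ ℕ._+_ (eq t ≤-refl) (∑ℕ-cong t (λ i i<t → eq i (m<n⇒m<1+n i<t)))

∑ℚ-cong : ∀ t {f g} → (∀ i → i < t → f i ≡ g i) → ∑ℚ t f ≡ ∑ℚ t g
∑ℚ-cong zero    eq = refl
∑ℚ-cong (suc t) eq = cong₂ ℚ._+_ (eq t ≤-refl) (∑ℚ-cong t (λ i i<t → eq i (m<n⇒m<1+n i<t)))

ℕtoℚ-∑ℕ : ∀ t f → ℕtoℚ (∑ℕ t f) ≡ ∑ℚ t (λ i → ℕtoℚ (f i))
ℕtoℚ-∑ℕ zero    f = refl
ℕtoℚ-∑ℕ (suc t) f = trans (ℕtoℚ-+ (f t) (∑ℕ t f)) (cong (ℕtoℚ (f t) ℚ.+_) (ℕtoℚ-∑ℕ t f))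

ℤtoℚ-∑ℤ : ∀ t f → ℤtoℚ (∑ℤ t f) ≡ ∑ℚ t (λ i → ℤtoℚ (f i))
ℤtoℚ-∑ℤ zero    f = refl
ℤtoℚ-∑ℤ (suc t) f = trans (ℤtoℚ-+ (f t) (∑ℤ t f)) (cong (ℤtoℚ (f t) ℚ.+_) (ℤtoℚ-∑ℤ t f))

∑ℚ-telescope : ∀ (r : ℕ → ℚ) t → ∑ℚ t (λ i → r (suc i) ℚ.- r i) ≡ r t ℚ.- r 0
∑ℚ-telescope r zero    = sym (ℚ.+-inverseʳ (r 0))
∑ℚ-telescope r (suc t) = trans (cong (r (suc t) ℚ.- r t ℚ.+_) (∑ℚ-telescope r t))
  (solve 3 (λ x y z → (x :- y) :+ (y :- z) := x :- z) refl (r (suc t)) (r t) (r 0))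

∑ℚ-injective : ∀ n {f g} → (∀ t → t ≤ n → ∑ℚ t f ≡ ∑ℚ t g) → ∀ i → i < n → f i ≡ g i
∑ℚ-injective n {f} {g} eq i i<n = GroupProperties.∙-cancelʳ ℚ.+-0-group (∑ℚ i g) (f i) (g i) (begin
  f i ℚ.+ ∑ℚ i g   ≡⟨ cong (f i ℚ.+_) (eq i (<⇒≤ i<n)) ⟨
  ∑ℚ (suc i) f     ≡⟨ eq (suc i) i<n ⟩
  ∑ℚ (suc i) g     ∎)
  where open ≡-Reasoning

∑ℤ-injective : ∀ n {f g} → (∀ t → t ≤ n → ∑ℤ t f ≡ ∑ℤ t g) → ∀ i → i < n → f i ≡ g i
∑ℤ-injective n {f} {g} eq i i<n =
  GroupProperties.∙-cancelʳ (AbelianGroup.group ℤ.+-0-abelianGroup) (∑ℤ i g) (f i) (g i) (begin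
  f i ℤ.+ ∑ℤ i g   ≡⟨ cong (ℤ._+_ (f i)) (eq i (<⇒≤ i<n)) ⟨
  ∑ℤ (suc i) f     ≡⟨ eq (suc i) i<n ⟩
  ∑ℤ (suc i) g     ∎)
  where open ≡-Reasoning

↭-from-same-elements : ∀ {A : Set} {xs ys : List A} → Unique xs → Unique ys →
                       (∀ {x} → x ∈ xs → x ∈ ys) → (∀ {x} → x ∈ ys → x ∈ xs) → xs ↭ ys
↭-from-same-elements u v to from = ∼bag⇒↭ (unique∧set⇒bag u v (mk⇔ to from))

∈-lookup : ∀ {n} (a : Vec ℕ n) i → lookup a i ∈ toList a
∈-lookup a i = Vec.∈-toList⁺ (Vec.∈-lookup i a)

∈⇒lookup : ∀ {n} (a : Vec ℕ n) {y} → y ∈ toList a → ∃ λ i → lookup a i ≡ y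
∈⇒lookup a y∈a with p ← Vec.∈-toList⁻ y∈a = VecAny.index p , sym (lookup-index p)

∈-map-suc-upTo⁻ : ∀ {n y} → y ∈ map suc (upTo n) → 1 ≤ y × y ≤ n
∈-map-suc-upTo⁻ y∈ with x , x∈ , refl ← ∈-map⁻ suc y∈ = s≤s z≤n , ∈-upTo⁻ x∈

∈-map-suc-upTo⁺ : ∀ {n y} → 1 ≤ y → y ≤ n → y ∈ map suc (upTo n)
∈-map-suc-upTo⁺ {y = suc y} _ y≤n = ∈-map⁺ suc (∈-upTo⁺ y≤n)

IsPerm⇒Unique : ∀ {n} {a : Vec ℕ n} → IsPerm n a → Unique (toList a)
IsPerm⇒Unique {n} a↭ = Permutationₛ.Unique-resp-↭ (setoid ℕ) (↭⇒↭ₛ (↭-sym a↭))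
  (Unique.map⁺ suc-injective (Unique.upTo⁺ n))

IsPerm⇒bounds : ∀ {n} {a : Vec ℕ n} → IsPerm n a → ∀ i → 1 ≤ lookup a i × lookup a i ≤ n
IsPerm⇒bounds {a = a} a↭ i = ∈-map-suc-upTo⁻ (∈-resp-↭ a↭ (∈-lookup a i))

Unique⇒lookup-injective : ∀ {n} (a : Vec ℕ n) → Unique (toList a) →
                          ∀ i j → lookup a i ≡ lookup a j → i ≡ j
Unique⇒lookup-injective (x ∷ a) u        Fin.zero    Fin.zero    _  = refl
Unique⇒lookup-injective (x ∷ a) (x∉ ∷ _) Fin.zero    (Fin.suc j) eq = ⊥-elim (All.lookup x∉ (∈-lookup a j) eq)
Unique⇒lookup-injective (x ∷ a) (x∉ ∷ _) (Fin.suc i) Fin.zero    eq = ⊥-elim (All.lookup x∉ (∈-lookup a i) (sym eq))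
Unique⇒lookup-injective (x ∷ a) (_ ∷ u)  (Fin.suc i) (Fin.suc j) eq =
  cong Fin.suc (Unique⇒lookup-injective a u i j eq)

lookup-injective⇒Unique : ∀ {n} (a : Vec ℕ n) → (∀ i j → lookup a i ≡ lookup a j → i ≡ j) →
                          Unique (toList a)
lookup-injective⇒Unique []      _   = []
lookup-injective⇒Unique (x ∷ a) inj =
  All.tabulate (λ y∈a x≡y → let j , aj≡y = ∈⇒lookup a y∈a in
                 Fin.0≢1+n (inj Fin.zero (Fin.suc j) (trans x≡y (sym aj≡y))))
  ∷ lookup-injective⇒Unique a (λ i j eq → Fin.suc-injective (inj (Fin.suc i) (Fin.suc j) eq))

IsPerm-intro : ∀ {n} (a : Vec ℕ n) → (∀ i j → lookup a i ≡ lookup a j → i ≡ j) →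
               (∀ i → 1 ≤ lookup a i × lookup a i ≤ n) →
               (∀ y → 1 ≤ y → y ≤ n → ∃ λ i → lookup a i ≡ y) → IsPerm n a
IsPerm-intro {n} a inj bounds onto = ↭-from-same-elements
  (lookup-injective⇒Unique a inj) (Unique.map⁺ suc-injective (Unique.upTo⁺ n))
  (λ y∈a → let i , ai≡y = ∈⇒lookup a y∈a
               1≤ai , ai≤n = bounds i
           in subst (_∈ map suc (upTo n)) ai≡y (∈-map-suc-upTo⁺ 1≤ai ai≤n))
  (λ y∈ → let 1≤y , y≤n = ∈-map-suc-upTo⁻ y∈
              i , ai≡y = onto _ 1≤y y≤n
          in subst (_∈ toList a) ai≡y (∈-lookup a i))

-- The vertices

decreasing-in-[1,n] : ∀ n (g : ℕ → ℕ) → (∀ t → suc t < n → g (suc t) < g t) →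
                      (∀ t → t < n → 1 ≤ g t × g t ≤ n) → ∀ t → t < n → g t + t ≡ n
decreasing-in-[1,n] n g decreasing bounds t t<n = ≤-antisym (upper t t<n) (lower (n ∸ suc t) t (m∸n+n≡m t<n))
  where
  open ≤-Reasoning
  upper : ∀ t → t < n → g t + t ≤ n
  upper zero    0<n   = subst (_≤ n) (sym (+-identityʳ (g 0))) (proj₂ (bounds 0 0<n))
  upper (suc t) t+1<n = begin
    g (suc t) + suc t   ≡⟨ +-suc (g (suc t)) t ⟩
    suc (g (suc t)) + t ≤⟨ +-monoˡ-≤ t (decreasing t t+1<n) ⟩
    g t + t             ≤⟨ upper t (<-trans (n<1+n t) t+1<n) ⟩
    n                   ∎
  lower : ∀ d t → d + suc t ≡ n → n ≤ g t + t
  lower zero    t t+1≡n = begin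
    n         ≡⟨ t+1≡n ⟨
    1 + t     ≤⟨ +-monoˡ-≤ t (proj₁ (bounds t (subst (t <_) t+1≡n ≤-refl))) ⟩
    g t + t   ∎
  lower (suc d) t d+t+2≡n = begin
    n                   ≤⟨ lower d (suc t) (trans (+-suc d (suc t)) d+t+2≡n) ⟩
    g (suc t) + suc t   ≡⟨ +-suc (g (suc t)) t ⟩
    suc (g (suc t)) + t ≤⟨ +-monoˡ-≤ t (decreasing t (subst (suc (suc t) ≤_) d+t+2≡n (s≤s (m≤n+m (suc t) d)))) ⟩
    g t + t             ∎

-- Coordinate i (counted from 0) of the vertex (k, k-1, …, k-p+1, k+1, k-p, …, 1), whose maximum is at p.
opaque
  vertex : ℕ → ℕ → ℕ → ℕ
  vertex k p i with <-cmp i p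
  ... | tri< _ _ _ = k ∸ i
  ... | tri≈ _ _ _ = suc k
  ... | tri> _ _ _ = suc k ∸ i

  vertex-< : ∀ {k p i} → i < p → vertex k p i ≡ k ∸ i
  vertex-< {k} {p} {i} i<p with <-cmp i p
  ... | tri< _ _ _    = refl
  ... | tri≈ i≮p _ _ = ⊥-elim (i≮p i<p)
  ... | tri> i≮p _ _ = ⊥-elim (i≮p i<p)

  vertex-≡ : ∀ k p → vertex k p p ≡ suc k
  vertex-≡ k p with <-cmp p p
  ... | tri< _ p≢p _ = ⊥-elim (p≢p refl)
  ... | tri≈ _ _ _    = refl
  ... | tri> _ p≢p _ = ⊥-elim (p≢p refl)

  vertex-> : ∀ {k p i} → p < i → vertex k p i ≡ suc k ∸ i
  vertex-> {k} {p} {i} p<i with <-cmp i p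
  ... | tri< _ _ p≮i = ⊥-elim (p≮i p<i)
  ... | tri≈ _ _ p≮i = ⊥-elim (p≮i p<i)
  ... | tri> _ _ _    = refl

vertexVec : (k p : ℕ) → Vec ℕ (suc k)
vertexVec k p = tabulate (λ i → vertex k p (toℕ i))

vertex-decreasing : ∀ {k p i j} → p ≤ k → i < j → j ≤ k → j ≢ p → vertex k p j < vertex k p i
vertex-decreasing {k} {p} {i} {j} p≤k i<j j≤k j≢p with <-cmp j p | <-cmp i p
... | tri≈ _ j≡p _ | _ = ⊥-elim (j≢p j≡p)
... | tri< j<p _ _ | _ = subst₂ _<_ (sym (vertex-< j<p)) (sym (vertex-< (<-trans i<j j<p)))
  (∸-monoʳ-< i<j (≤-trans (<⇒≤ j<p) p≤k))
... | tri> _ _ p<j | tri< i<p _ _ = subst₂ _<_ (sym (vertex-> p<j)) (sym (vertex-< i<p))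
  (∸-monoʳ-< (<-≤-trans (s≤s i<p) p<j) (m≤n⇒m≤1+n j≤k))
... | tri> _ _ p<j | tri≈ _ refl _ = subst₂ _<_ (sym (vertex-> p<j)) (sym (vertex-≡ k i))
  (∸-monoʳ-< (≤-trans (s≤s z≤n) p<j) (m≤n⇒m≤1+n j≤k))
... | tri> _ _ p<j | tri> _ _ p<i = subst₂ _<_ (sym (vertex-> p<j)) (sym (vertex-> p<i))
  (∸-monoʳ-< i<j (m≤n⇒m≤1+n j≤k))

vertex-below-max : ∀ {k p i} → i ≢ p → vertex k p i ≤ k
vertex-below-max {k} {p} {i} i≢p with <-cmp i p
... | tri< i<p _ _ = subst (_≤ k) (sym (vertex-< i<p)) (m∸n≤m k i)
... | tri≈ _ i≡p _ = ⊥-elim (i≢p i≡p)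
... | tri> _ _ p<i = subst (_≤ k) (sym (vertex-> p<i)) (∸-monoʳ-≤ (suc k) (≤-trans (s≤s z≤n) p<i))

vertex-bounds : ∀ {k p i} → p ≤ k → i ≤ k → 1 ≤ vertex k p i × vertex k p i ≤ suc k
vertex-bounds {k} {p} {i} p≤k i≤k with <-cmp i p
... | tri< i<p _ _ = subst (λ v → 1 ≤ v × v ≤ suc k) (sym (vertex-< i<p))
  (m<n⇒0<n∸m (<-≤-trans i<p p≤k) , ≤-trans (m∸n≤m k i) (n≤1+n k))
... | tri≈ _ refl _ = subst (λ v → 1 ≤ v × v ≤ suc k) (sym (vertex-≡ k i)) (s≤s z≤n , ≤-refl)
... | tri> _ _ p<i = subst (λ v → 1 ≤ v × v ≤ suc k) (sym (vertex-> p<i))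
  (m<n⇒0<n∸m (s≤s i≤k) , m∸n≤m (suc k) i)

vertex-distinct : ∀ {k p i j} → p ≤ k → i < j → j ≤ k → vertex k p i ≢ vertex k p j
vertex-distinct {k} {p} {i} {j} p≤k i<j j≤k eq with j ℕ.≟ p
... | no j≢p    = <-irrefl (sym eq) (vertex-decreasing p≤k i<j j≤k j≢p)
... | yes refl = <-irrefl eq (subst (vertex k p i <_) (sym (vertex-≡ k p)) (s≤s (vertex-below-max (<⇒≢ i<j))))

vertex-injective : ∀ {k p i j} → p ≤ k → i ≤ k → j ≤ k → vertex k p i ≡ vertex k p j → i ≡ j
vertex-injective {k} {p} {i} {j} p≤k i≤k j≤k eq with <-cmp i j
... | tri< i<j _ _ = ⊥-elim (vertex-distinct p≤k i<j j≤k eq)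
... | tri≈ _ i≡j _ = i≡j
... | tri> _ _ j<i = ⊥-elim (vertex-distinct p≤k j<i i≤k (sym eq))

vertex-onto : ∀ {k p y} → p ≤ k → 1 ≤ y → y ≤ suc k → ∃ λ i → i ≤ k × vertex k p i ≡ y
vertex-onto {k} {p} {y} p≤k 1≤y y≤k+1 with m≤n⇒m<n∨m≡n y≤k+1
... | inj₂ refl = p , p≤k , vertex-≡ k p
... | inj₁ (s≤s y≤k) with k <? p + y
...   | yes k<p+y = k ∸ y , m∸n≤m k y , trans (vertex-< k∸y<p) (m∸[m∸n]≡n y≤k)
  where
  k∸y<p : k ∸ y < p
  k∸y<p = +-cancelʳ-< y (k ∸ y) p (subst (_< p + y) (sym (m∸n+n≡m y≤k)) k<p+y)
...   | no k≮p+y = suc k ∸ y , ∸-monoʳ-≤ (suc k) 1≤y , trans (vertex-> p<k+1∸y) (m∸[m∸n]≡n y≤k+1)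
  where
  p<k+1∸y : p < suc k ∸ y
  p<k+1∸y = +-cancelʳ-< y p (suc k ∸ y) (subst (p + y <_) (sym (m∸n+n≡m y≤k+1)) (s≤s (≮⇒≥ k≮p+y)))

ascent⇒max-position : ∀ {k p i j} → p ≤ k → i < j → j ≤ k → vertex k p i < vertex k p j → j ≡ p
ascent⇒max-position p≤k i<j j≤k ascent with _ ℕ.≟ _
... | yes j≡p = j≡p
... | no j≢p  = ⊥-elim (<-asym ascent (vertex-decreasing p≤k i<j j≤k j≢p))

isVertex-vertexVec : ∀ {k p} → p ≤ k → IsVertex (suc k) (vertexVec k p)
isVertex-vertexVec {k} {p} p≤k = perm , avoid123 , avoid132 , avoid312
  where
  v : Fin (suc k) → ℕ
  v i = vertex k p (toℕ i)
  a : Vec ℕ (suc k)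
  a = vertexVec k p
  lookup-a : ∀ i → lookup a i ≡ v i
  lookup-a = lookup∘tabulate v
  index≤k : ∀ (i : Fin (suc k)) → toℕ i ≤ k
  index≤k i = ≤-pred (toℕ<n i)
  perm : IsPerm (suc k) a
  perm = IsPerm-intro a
    (λ i j eq → toℕ-injective (vertex-injective p≤k (index≤k i) (index≤k j)
                  (trans (sym (lookup-a i)) (trans eq (lookup-a j)))))
    (λ i → subst (λ x → 1 ≤ x × x ≤ suc k) (sym (lookup-a i)) (vertex-bounds p≤k (index≤k i)))
    (λ y 1≤y y≤k+1 → let i , i≤k , vi≡y = vertex-onto p≤k 1≤y y≤k+1 in
      fromℕ< (s≤s i≤k) , trans (lookup-a _) (trans (cong (vertex k p) (toℕ-fromℕ< (s≤s i≤k))) vi≡y))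
  ascent⇒p : ∀ i j → toℕ i < toℕ j → lookup a i < lookup a j → toℕ j ≡ p
  ascent⇒p i j i<j ai<aj = ascent⇒max-position p≤k i<j (index≤k j) (subst₂ _<_ (lookup-a i) (lookup-a j) ai<aj)
  below-max : ∀ i j → toℕ i ≡ p → ¬ lookup a i < lookup a j
  below-max i j refl ai<aj = <⇒≱ (subst₂ _<_ (trans (lookup-a i) (vertex-≡ k (toℕ i))) (lookup-a j) ai<aj)
    (proj₂ (vertex-bounds p≤k (index≤k j)))
  avoid123 : Avoids123 (suc k) a
  avoid123 i j l i<j j<l (ai<aj , aj<al) =
    <-irrefl (trans (ascent⇒p i j i<j ai<aj) (sym (ascent⇒p j l j<l aj<al))) j<l
  avoid132 : Avoids132 (suc k) a
  avoid132 i j l i<j j<l (ai<al , al<aj) = below-max l j (ascent⇒p i l (<-trans i<j j<l) ai<al) al<aj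
  avoid312 : Avoids312 (suc k) a
  avoid312 i j l i<j j<l (aj<al , al<ai) = below-max l i (ascent⇒p j l j<l aj<al) al<ai

avoids-lookupOr : ∀ {n} (a : Vec ℕ n) (R : ℕ → ℕ → ℕ → Set) →
             (∀ (i j l : Fin n) → i Fin.< j → j Fin.< l → ¬ R (lookup a i) (lookup a j) (lookup a l)) →
             ∀ {i j l} → i < j → j < l → l < n → ¬ R (lookupOr 0 a i) (lookupOr 0 a j) (lookupOr 0 a l)
avoids-lookupOr {n} a R avoid {i} {j} {l} i<j j<l l<n r =
  avoid (fromℕ< i<n) (fromℕ< j<n) (fromℕ< l<n) (index-< i<n j<n i<j) (index-< j<n l<n j<l)
    (subst₂ (λ x y → R x y _) (lookupOr-fromℕ< 0 a i<n) (lookupOr-fromℕ< 0 a j<n)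
      (subst (R _ _) (lookupOr-fromℕ< 0 a l<n) r))
  where
  j<n : j < n
  j<n = <-trans j<l l<n
  i<n : i < n
  i<n = <-trans i<j j<n
  index-< : ∀ {x y} (x<n : x < n) (y<n : y < n) → x < y → fromℕ< x<n Fin.< fromℕ< y<n
  index-< x<n y<n = subst₂ _<_ (sym (toℕ-fromℕ< x<n)) (sym (toℕ-fromℕ< y<n))

opaque
  skip : ℕ → ℕ → ℕ
  skip p t with t <? p
  ... | yes _ = t
  ... | no  _ = suc t

  skip-< : ∀ {p t} → t < p → skip p t ≡ t
  skip-< {p} {t} t<p with t <? p
  ... | yes _   = refl
  ... | no t≮p = ⊥-elim (t≮p t<p)

  skip-≥ : ∀ {p t} → p ≤ t → skip p t ≡ suc t
  skip-≥ {p} {t} p≤t with t <? p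
  ... | yes t<p = ⊥-elim (<⇒≱ t<p p≤t)
  ... | no _    = refl

skip-≢ : ∀ p t → skip p t ≢ p
skip-≢ p t with t <? p
... | yes t<p = λ eq → <⇒≢ t<p (trans (sym (skip-< t<p)) eq)
... | no t≮p  = λ eq → <⇒≢ (s≤s (≮⇒≥ t≮p)) (trans (sym eq) (skip-≥ (≮⇒≥ t≮p)))

skip-increasing : ∀ p t → skip p t < skip p (suc t)
skip-increasing p t with suc t <? p
... | yes t+1<p = subst₂ _<_ (sym (skip-< (<-trans (n<1+n t) t+1<p))) (sym (skip-< t+1<p)) (n<1+n t)
... | no t+1≮p with t <? p
...   | yes t<p = subst₂ _<_ (sym (skip-< t<p)) (sym (skip-≥ (≮⇒≥ t+1≮p))) (m<n⇒m<1+n (n<1+n t))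
...   | no t≮p  = subst₂ _<_ (sym (skip-≥ (≮⇒≥ t≮p))) (sym (skip-≥ (≮⇒≥ t+1≮p))) (n<1+n (suc t))

skip-≤ : ∀ p {t k} → t < k → skip p t ≤ k
skip-≤ p {t} t<k with t <? p
... | yes t<p = subst (_≤ _) (sym (skip-< t<p)) (<⇒≤ t<k)
... | no t≮p  = subst (_≤ _) (sym (skip-≥ (≮⇒≥ t≮p))) t<k

decreasing-around-max⇒vertex : ∀ k p (F : ℕ → ℕ) → p ≤ k → F p ≡ suc k →
  (∀ i → i ≤ k → i ≢ p → 1 ≤ F i × F i ≤ k) →
  (∀ i j → i < j → j ≤ k → i ≢ p → j ≢ p → F j < F i) →
  ∀ i → i ≤ k → F i ≡ vertex k p i
decreasing-around-max⇒vertex k p F p≤k Fp≡k+1 bounds decreasing = F≡vertex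
  where
  g : ℕ → ℕ
  g t = F (skip p t)
  g+t≡k : ∀ t → t < k → g t + t ≡ k
  g+t≡k = decreasing-in-[1,n] k g
    (λ t t+1<k → decreasing (skip p t) (skip p (suc t)) (skip-increasing p t) (skip-≤ p t+1<k)
                   (skip-≢ p t) (skip-≢ p (suc t)))
    (λ t t<k → bounds (skip p t) (skip-≤ p t<k) (skip-≢ p t))
  open ≡-Reasoning
  F≡vertex : ∀ i → i ≤ k → F i ≡ vertex k p i
  F≡vertex i i≤k with <-cmp i p
  ... | tri≈ _ refl _ = trans Fp≡k+1 (sym (vertex-≡ k i))
  ... | tri< i<p _ _ = begin
    F i             ≡⟨ m+n∸n≡m (F i) i ⟨
    F i + i ∸ i     ≡⟨ cong (λ x → F x + i ∸ i) (skip-< i<p) ⟨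
    g i + i ∸ i     ≡⟨ cong (_∸ i) (g+t≡k i (<-≤-trans i<p p≤k)) ⟩
    k ∸ i           ≡⟨ vertex-< i<p ⟨
    vertex k p i    ∎
  ... | tri> _ _ p<i@(s≤s {n = t} p≤t) = begin
    F (suc t)             ≡⟨ m+n∸n≡m (F (suc t)) t ⟨
    F (suc t) + t ∸ t     ≡⟨ cong (λ x → F x + t ∸ t) (skip-≥ p≤t) ⟨
    g t + t ∸ t           ≡⟨ cong (_∸ t) (g+t≡k t i≤k) ⟩
    k ∸ t                 ≡⟨ vertex-> p<i ⟨
    vertex k p (suc t)    ∎

vertex-characterization : ∀ {k} {a : Vec ℕ (suc k)} → IsVertex (suc k) a → ∃ λ p → p ≤ k × a ≡ vertexVec k p
vertex-characterization {k} {a} (perm , avoid123 , avoid132 , avoid312) =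
  p , p≤k , trans (sym (tabulate∘lookup a))
              (tabulate-cong (λ i → trans (sym (lookupOr-toℕ 0 a i)) (F≡vertex (toℕ i) (≤-pred (toℕ<n i)))))
  where
  F : ℕ → ℕ
  F = lookupOr 0 a
  F-lookup : ∀ {i} (i≤k : i ≤ k) → F i ≡ lookup a (fromℕ< (s≤s i≤k))
  F-lookup i≤k = lookupOr-fromℕ< 0 a (s≤s i≤k)
  F-bounds : ∀ {i} → i ≤ k → 1 ≤ F i × F i ≤ suc k
  F-bounds i≤k = subst (λ x → 1 ≤ x × x ≤ suc k) (sym (F-lookup i≤k)) (IsPerm⇒bounds perm _)
  F-injective : ∀ {i j} → i ≤ k → j ≤ k → F i ≡ F j → i ≡ j
  F-injective i≤k j≤k eq = trans (sym (toℕ-fromℕ< (s≤s i≤k))) (trans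
    (cong toℕ (Unique⇒lookup-injective a (IsPerm⇒Unique perm) _ _
      (trans (sym (F-lookup i≤k)) (trans eq (F-lookup j≤k)))))
    (toℕ-fromℕ< (s≤s j≤k)))
  max : ∃ λ q → lookup a q ≡ suc k
  max = ∈⇒lookup a (∈-resp-↭ (↭-sym perm) (∈-map-suc-upTo⁺ (s≤s z≤n) ≤-refl))
  p : ℕ
  p = toℕ (proj₁ max)
  p≤k : p ≤ k
  p≤k = ≤-pred (toℕ<n (proj₁ max))
  Fp≡k+1 : F p ≡ suc k
  Fp≡k+1 = trans (lookupOr-toℕ 0 a (proj₁ max)) (proj₂ max)
  below-max : ∀ {i} → i ≤ k → i ≢ p → F i < F p
  below-max i≤k i≢p with m≤n⇒m<n∨m≡n (proj₂ (F-bounds i≤k))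
  ... | inj₁ Fi<k+1 = subst (_ <_) (sym Fp≡k+1) Fi<k+1
  ... | inj₂ Fi≡k+1 = ⊥-elim (i≢p (F-injective i≤k p≤k (trans Fi≡k+1 (sym Fp≡k+1))))
  -- An ascent away from the maximum would form a 312, 132 or 123 pattern with it.
  no-ascent : ∀ {i j} → i < j → j ≤ k → i ≢ p → j ≢ p → ¬ F i < F j
  no-ascent {i} {j} i<j j≤k i≢p j≢p Fi<Fj with <-cmp p i | <-cmp j p
  ... | tri≈ _ p≡i _ | _ = i≢p (sym p≡i)
  ... | _ | tri≈ _ j≡p _ = j≢p j≡p
  ... | tri< p<i _ _ | _ =
    avoids-lookupOr a (λ x y z → y < z × z < x) avoid312 p<i i<j (s≤s j≤k) (Fi<Fj , below-max j≤k j≢p)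
  ... | tri> _ _ i<p | tri> _ _ p<j =
    avoids-lookupOr a (λ x y z → x < z × z < y) avoid132 i<p p<j (s≤s j≤k) (Fi<Fj , below-max j≤k j≢p)
  ... | tri> _ _ i<p | tri< j<p _ _ =
    avoids-lookupOr a (λ x y z → x < y × y < z) avoid123 i<j j<p (s≤s p≤k) (Fi<Fj , below-max j≤k j≢p)
  decreasing : ∀ i j → i < j → j ≤ k → i ≢ p → j ≢ p → F j < F i
  decreasing i j i<j j≤k i≢p j≢p with <-cmp (F j) (F i)
  ... | tri< Fj<Fi _ _ = Fj<Fi
  ... | tri≈ _ Fj≡Fi _ = ⊥-elim (<⇒≢ i<j (F-injective (≤-trans (<⇒≤ i<j) j≤k) j≤k (sym Fj≡Fi)))
  ... | tri> _ _ Fi<Fj = ⊥-elim (no-ascent i<j j≤k i≢p j≢p Fi<Fj)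
  F≡vertex : ∀ i → i ≤ k → F i ≡ vertex k p i
  F≡vertex = decreasing-around-max⇒vertex k p F p≤k Fp≡k+1
    (λ i i≤k i≢p → proj₁ (F-bounds i≤k) , ≤-pred (subst (_ <_) Fp≡k+1 (below-max i≤k i≢p)))
    decreasing

staircase : ℕ → ℕ → ℕ
staircase k t = ∑ℕ t (k ∸_)

opaque
  jump : ℕ → ℕ → ℕ
  jump p t with p <? t
  ... | yes _ = t
  ... | no  _ = 0

  jump-≥ : ∀ {p t} → t ≤ p → jump p t ≡ 0
  jump-≥ {p} {t} t≤p with p <? t
  ... | yes p<t = ⊥-elim (<⇒≱ p<t t≤p)
  ... | no  _   = refl

  jump-< : ∀ {p t} → p < t → jump p t ≡ t
  jump-< {p} {t} p<t with p <? t
  ... | yes _   = refl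
  ... | no p≮t = ⊥-elim (p≮t p<t)

vertex-step : ∀ k p t → t ≤ k → vertex k p t + jump p t ≡ k ∸ t + jump p (suc t)
vertex-step k p t t≤k with <-cmp t p
... | tri< t<p _ _ = begin
  vertex k p t + jump p t   ≡⟨ cong₂ _+_ (vertex-< t<p) (jump-≥ (<⇒≤ t<p)) ⟩
  k ∸ t + 0                 ≡⟨ cong (_+_ (k ∸ t)) (jump-≥ t<p) ⟨
  k ∸ t + jump p (suc t)    ∎
  where open ≡-Reasoning
... | tri≈ _ refl _ = begin
  vertex k t t + jump t t   ≡⟨ cong₂ _+_ (vertex-≡ k t) (jump-≥ ≤-refl) ⟩
  suc k + 0                 ≡⟨ +-identityʳ (suc k) ⟩
  suc k                     ≡⟨ trans (+-suc (k ∸ t) t) (cong suc (m∸n+n≡m t≤k)) ⟨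
  k ∸ t + suc t             ≡⟨ cong (_+_ (k ∸ t)) (jump-< ≤-refl) ⟨
  k ∸ t + jump t (suc t)    ∎
  where open ≡-Reasoning
... | tri> _ _ p<t = begin
  vertex k p t + jump p t   ≡⟨ cong₂ _+_ (vertex-> p<t) (jump-< p<t) ⟩
  suc k ∸ t + t             ≡⟨ cong (_+ t) (+-∸-assoc 1 t≤k) ⟩
  suc (k ∸ t + t)           ≡⟨ +-suc (k ∸ t) t ⟨
  k ∸ t + suc t             ≡⟨ cong (_+_ (k ∸ t)) (jump-< (m<n⇒m<1+n p<t)) ⟨
  k ∸ t + jump p (suc t)    ∎
  where open ≡-Reasoning

∑ℕ-vertex : ∀ k p t → t ≤ suc k → ∑ℕ t (vertex k p) ≡ staircase k t + jump p t
∑ℕ-vertex k p zero    _       = sym (jump-≥ z≤n)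
∑ℕ-vertex k p (suc t) (s≤s t≤k) = begin
  vertex k p t + ∑ℕ t (vertex k p)                  ≡⟨ cong (_+_ (vertex k p t)) (∑ℕ-vertex k p t (m≤n⇒m≤1+n t≤k)) ⟩
  vertex k p t + (staircase k t + jump p t)          ≡⟨ x+[y+z]≡y+[x+z] (vertex k p t) (staircase k t) (jump p t) ⟩
  staircase k t + (vertex k p t + jump p t)          ≡⟨ cong (_+_ (staircase k t)) (vertex-step k p t t≤k) ⟩
  staircase k t + (k ∸ t + jump p (suc t))           ≡⟨ x+[y+z]≡y+[x+z] (staircase k t) (k ∸ t) (jump p (suc t)) ⟩
  k ∸ t + (staircase k t + jump p (suc t))           ≡⟨ +-assoc (k ∸ t) (staircase k t) (jump p (suc t)) ⟨
  staircase k (suc t) + jump p (suc t)               ∎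
  where
  open ≡-Reasoning
  x+[y+z]≡y+[x+z] : ∀ x y z → x + (y + z) ≡ y + (x + z)
  x+[y+z]≡y+[x+z] = solve-∀

∑ℕ-vertexVec : ∀ k p t → t ≤ suc k → ∑ℕ t (lookupOr 0 (vertexVec k p)) ≡ staircase k t + jump p t
∑ℕ-vertexVec k p t t≤k+1 = trans (∑ℕ-cong t (λ i i<t → lookupOr-tabulate 0 (vertex k p) (<-≤-trans i<t t≤k+1)))
                                  (∑ℕ-vertex k p t t≤k+1)

excess : (k : ℕ) → Vec ℕ (suc k) → ℕ → ℕ
excess k a t = ∑ℕ t (lookupOr 0 a) ∸ staircase k t

excess-vertexVec : ∀ k p t → t ≤ suc k → excess k (vertexVec k p) t ≡ jump p t
excess-vertexVec k p t t≤k+1 =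
  trans (cong (_∸ staircase k t) (∑ℕ-vertexVec k p t t≤k+1)) (m+n∸m≡n (staircase k t) (jump p t))

jump-step : ∀ p t → suc t * jump p t ≤ t * jump p (suc t)
jump-step p t with p <? t
... | yes p<t = ≤-reflexive (begin
  suc t * jump p t        ≡⟨ cong (suc t *_) (jump-< p<t) ⟩
  suc t * t               ≡⟨ *-comm (suc t) t ⟩
  t * suc t               ≡⟨ cong (t *_) (jump-< (m<n⇒m<1+n p<t)) ⟨
  t * jump p (suc t)      ∎)
  where open ≡-Reasoning
... | no p≮t = subst (_≤ t * jump p (suc t))
  (sym (trans (cong (suc t *_) (jump-≥ (≮⇒≥ p≮t))) (*-zeroʳ (suc t)))) z≤n

module _ {k} {a : Vec ℕ (suc k)} (a-vertex : IsVertex (suc k) a) where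

  private
    p : ℕ
    p = proj₁ (vertex-characterization a-vertex)
    p≤k : p ≤ k
    p≤k = proj₁ (proj₂ (vertex-characterization a-vertex))
    a≡vertexVec : a ≡ vertexVec k p
    a≡vertexVec = proj₂ (proj₂ (vertex-characterization a-vertex))

  ∑ℕ-isVertex : ∀ t → t ≤ suc k → ∑ℕ t (lookupOr 0 a) ≡ staircase k t + excess k a t
  ∑ℕ-isVertex t t≤k+1 rewrite a≡vertexVec =
    trans (∑ℕ-vertexVec k p t t≤k+1) (cong (_+_ (staircase k t)) (sym (excess-vertexVec k p t t≤k+1)))

  excess-step : ∀ t → t ≤ k → suc t * excess k a t ≤ t * excess k a (suc t)
  excess-step t t≤k
    rewrite a≡vertexVec | excess-vertexVec k p t (m≤n⇒m≤1+n t≤k) | excess-vertexVec k p (suc t) (s≤s t≤k) =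
    jump-step p t

  excess-top : excess k a (suc k) ≡ suc k
  excess-top rewrite a≡vertexVec = trans (excess-vertexVec k p (suc k) ≤-refl) (jump-< (s≤s p≤k))

combination : ∀ {n} → List (ℚ × Vec ℕ n) → ℕ → ℚ
combination cs i = sumℚ (map (λ c → proj₁ c ℚ.* ℕtoℚ (lookupOr 0 (proj₂ c) i)) cs)

combination-toℕ : ∀ {n} (cs : List (ℚ × Vec ℕ n)) i →
                  combination cs (toℕ i) ≡ sumℚ (map (λ c → proj₁ c ℚ.* ℕtoℚ (lookup (proj₂ c) i)) cs)
combination-toℕ cs i =
  cong sumℚ (map-cong (λ c → cong (λ v → proj₁ c ℚ.* ℕtoℚ v) (lookupOr-toℕ 0 (proj₂ c) i)) cs)

∑ℚ-combination : ∀ {n} (cs : List (ℚ × Vec ℕ n)) t →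
  ∑ℚ t (combination cs) ≡ sumℚ (map (λ c → proj₁ c ℚ.* ℕtoℚ (∑ℕ t (lookupOr 0 (proj₂ c)))) cs)
∑ℚ-combination cs t = trans (sumℚ-swap (λ i c → proj₁ c ℚ.* ℕtoℚ (lookupOr 0 (proj₂ c) i)) (downFrom t) cs)
  (cong sumℚ (map-cong (λ c → trans (sumℚ-map-*ˡ (proj₁ c) (λ i → ℕtoℚ (lookupOr 0 (proj₂ c) i)) (downFrom t))
                                     (cong (proj₁ c ℚ.*_) (sym (ℕtoℚ-∑ℕ t (lookupOr 0 (proj₂ c)))))) cs))

∑ℚ-combination-of-vertices : ∀ {k} (cs : List (ℚ × Vec ℕ (suc k))) → All (λ c → IsVertex (suc k) (proj₂ c)) cs →
  ∀ t → t ≤ suc k →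
  ∑ℚ t (combination cs) ≡
    ℕtoℚ (staircase k t) ℚ.* sumℚ (map proj₁ cs) ℚ.+
    sumℚ (map (λ c → proj₁ c ℚ.* ℕtoℚ (excess k (proj₂ c) t)) cs)
∑ℚ-combination-of-vertices {k} cs vertices t t≤k+1 = trans (∑ℚ-combination cs t) (go cs vertices)
  where
  S : ℚ
  S = ℕtoℚ (staircase k t)
  go : ∀ cs → All (λ c → IsVertex (suc k) (proj₂ c)) cs →
       sumℚ (map (λ c → proj₁ c ℚ.* ℕtoℚ (∑ℕ t (lookupOr 0 (proj₂ c)))) cs) ≡
       S ℚ.* sumℚ (map proj₁ cs) ℚ.+ sumℚ (map (λ c → proj₁ c ℚ.* ℕtoℚ (excess k (proj₂ c) t)) cs)
  go []              []       = sym (cong (ℚ._+ 0ℚ) (ℚ.*-zeroʳ S))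
  go ((λ′ , a) ∷ cs) (v ∷ vs) = begin
    λ′ ℚ.* ℕtoℚ (∑ℕ t (lookupOr 0 a)) ℚ.+ _
      ≡⟨ cong₂ ℚ._+_ (cong (λ y → λ′ ℚ.* ℕtoℚ y) (∑ℕ-isVertex v t t≤k+1)) (go cs vs) ⟩
    λ′ ℚ.* ℕtoℚ (staircase k t ℕ.+ excess k a t) ℚ.+ (S ℚ.* M ℚ.+ W)
      ≡⟨ cong (λ y → λ′ ℚ.* y ℚ.+ (S ℚ.* M ℚ.+ W)) (ℕtoℚ-+ (staircase k t) (excess k a t)) ⟩
    λ′ ℚ.* (S ℚ.+ E) ℚ.+ (S ℚ.* M ℚ.+ W)
      ≡⟨ solve 5 (λ l s e m w → l :* (s :+ e) :+ (s :* m :+ w) := s :* (l :+ m) :+ (l :* e :+ w)) refl λ′ S E M W ⟩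
    S ℚ.* (λ′ ℚ.+ M) ℚ.+ (λ′ ℚ.* E ℚ.+ W) ∎
    where
    open ≡-Reasoning
    E M W : ℚ
    E = ℕtoℚ (excess k a t)
    M = sumℚ (map proj₁ cs)
    W = sumℚ (map (λ c → proj₁ c ℚ.* ℕtoℚ (excess k (proj₂ c) t)) cs)

∑ℚ-jump : ∀ (f : ℕ → ℚ) N t → t ≤ N →
          ∑ℚ N (λ p → f p ℚ.* ℕtoℚ (jump p t)) ≡ ℕtoℚ t ℚ.* ∑ℚ t f
∑ℚ-jump f zero    .zero z≤n    = refl
∑ℚ-jump f (suc N) t     t≤N+1 with m≤n⇒m<n∨m≡n t≤N+1
... | inj₁ (s≤s t≤N) = begin
  f N ℚ.* ℕtoℚ (jump N t) ℚ.+ ∑ℚ N (λ p → f p ℚ.* ℕtoℚ (jump p t))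
    ≡⟨ cong₂ ℚ._+_ (cong (λ j → f N ℚ.* ℕtoℚ j) (jump-≥ t≤N)) (∑ℚ-jump f N t t≤N) ⟩
  f N ℚ.* 0ℚ ℚ.+ ℕtoℚ t ℚ.* ∑ℚ t f
    ≡⟨ cong (ℚ._+ ℕtoℚ t ℚ.* ∑ℚ t f) (ℚ.*-zeroʳ (f N)) ⟩
  0ℚ ℚ.+ ℕtoℚ t ℚ.* ∑ℚ t f
    ≡⟨ ℚ.+-identityˡ (ℕtoℚ t ℚ.* ∑ℚ t f) ⟩
  ℕtoℚ t ℚ.* ∑ℚ t f ∎
  where open ≡-Reasoning
... | inj₂ refl = begin
  ∑ℚ t (λ p → f p ℚ.* ℕtoℚ (jump p t))   ≡⟨ ∑ℚ-cong t (λ p p<t → trans (cong (λ j → f p ℚ.* ℕtoℚ j) (jump-< p<t))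
                                                                   (ℚ.*-comm (f p) (ℕtoℚ t))) ⟩
  ∑ℚ t (λ p → ℕtoℚ t ℚ.* f p)            ≡⟨ sumℚ-map-*ˡ (ℕtoℚ t) f (downFrom t) ⟩
  ℕtoℚ t ℚ.* ∑ℚ t f                       ∎
  where open ≡-Reasoning

-- Lecture hall sequences

-- Λ t / t is a lecture hall sequence: 0 ≤ Λ 1 / 1 ≤ Λ 2 / 2 ≤ ⋯ ≤ Λ (k+1) / (k+1) = m.
record LectureHall (k m : ℕ) (Λ : ℕ → ℕ) : Set where
  field
    start : Λ 0 ≡ 0
    end   : Λ (suc k) ≡ suc k * m
    step  : ∀ t → t ≤ k → suc t * Λ t ≤ t * Λ (suc t)

latticeCoordinate : (k m : ℕ) → (ℕ → ℕ) → ℕ → ℤ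
latticeCoordinate k m Λ i = + ((k ∸ i) * m + Λ (suc i)) ℤ.- + Λ i

latticePoint : (k m : ℕ) → (ℕ → ℕ) → Vec ℤ (suc k)
latticePoint k m Λ = tabulate (λ i → latticeCoordinate k m Λ (toℕ i))

∑ℤ-latticePoint : ∀ k m Λ → Λ 0 ≡ 0 → ∀ t → t ≤ suc k →
                  ∑ℤ t (lookupOr 0ℤ (latticePoint k m Λ)) ≡ + (staircase k t * m + Λ t)
∑ℤ-latticePoint k m Λ Λ0≡0 zero    _         = cong +_ (sym Λ0≡0)
∑ℤ-latticePoint k m Λ Λ0≡0 (suc t) (s≤s t≤k) = begin
  lookupOr 0ℤ (latticePoint k m Λ) t ℤ.+ ∑ℤ t (lookupOr 0ℤ (latticePoint k m Λ))
    ≡⟨ cong₂ ℤ._+_ (lookupOr-tabulate 0ℤ (latticeCoordinate k m Λ) (s≤s t≤k))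
                   (∑ℤ-latticePoint k m Λ Λ0≡0 t (m≤n⇒m≤1+n t≤k)) ⟩
  + ((k ∸ t) * m + Λ (suc t)) ℤ.- + Λ t ℤ.+ + (staircase k t * m + Λ t)
    ≡⟨ telescope (+ ((k ∸ t) * m)) (+ (staircase k t * m)) (+ Λ (suc t)) (+ Λ t) ⟩
  + ((k ∸ t) * m + staircase k t * m + Λ (suc t))
    ≡⟨ cong (λ y → + (y + Λ (suc t))) (*-distribʳ-+ m (k ∸ t) (staircase k t)) ⟨
  + (staircase k (suc t) * m + Λ (suc t)) ∎
  where
  open ≡-Reasoning
  telescope : ∀ a b c d → a ℤ.+ c ℤ.- d ℤ.+ (b ℤ.+ d) ≡ a ℤ.+ b ℤ.+ c
  telescope = ℤ-Solver.solve-∀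

latticePoint-injective : ∀ {k m Λ Λ′} → Λ 0 ≡ 0 → Λ′ 0 ≡ 0 → latticePoint k m Λ ≡ latticePoint k m Λ′ →
                         ∀ t → t ≤ suc k → Λ t ≡ Λ′ t
latticePoint-injective {k} {m} {Λ} {Λ′} Λ0≡0 Λ′0≡0 eq t t≤k+1 = +-cancelˡ-≡ (staircase k t * m) (Λ t) (Λ′ t)
  (ℤ.+-injective (begin
    + (staircase k t * m + Λ t)                   ≡⟨ ∑ℤ-latticePoint k m Λ Λ0≡0 t t≤k+1 ⟨
    ∑ℤ t (lookupOr 0ℤ (latticePoint k m Λ))       ≡⟨ cong (λ x → ∑ℤ t (lookupOr 0ℤ x)) eq ⟩
    ∑ℤ t (lookupOr 0ℤ (latticePoint k m Λ′))      ≡⟨ ∑ℤ-latticePoint k m Λ′ Λ′0≡0 t t≤k+1 ⟩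
    + (staircase k t * m + Λ′ t)                  ∎))
  where open ≡-Reasoning

module _ {k m Λ} (hall : LectureHall k m Λ) where

  open LectureHall hall

  private
    ratio : ℕ → ℚ
    ratio zero    = 0ℚ
    ratio (suc t) = + Λ (suc t) / suc t

    toℚᵘ-ratio : ∀ t → toℚᵘ (ratio (suc t)) ℚᵘ.≃ mkℚᵘ (+ Λ (suc t)) t
    toℚᵘ-ratio t = ℚ.toℚᵘ-fromℚᵘ (mkℚᵘ (+ Λ (suc t)) t)

    ratio-* : ∀ t → ℕtoℚ t ℚ.* ratio t ≡ ℕtoℚ (Λ t)
    ratio-* zero    = cong ℕtoℚ (sym start)
    ratio-* (suc t) = ℚ.toℚᵘ-injective (begin
      toℚᵘ (ℕtoℚ (suc t) ℚ.* ratio (suc t))            ≈⟨ ℚ.toℚᵘ-homo-* (ℕtoℚ (suc t)) (ratio (suc t)) ⟩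
      toℚᵘ (ℕtoℚ (suc t)) ℚᵘ.* toℚᵘ (ratio (suc t))    ≈⟨ ℚᵘ.*-cong (toℚᵘ-ℤtoℚ (+ suc t)) (toℚᵘ-ratio t) ⟩
      mkℚᵘ (+ suc t) 0 ℚᵘ.* mkℚᵘ (+ Λ (suc t)) t       ≈⟨ *≡* cross ⟩
      mkℚᵘ (+ Λ (suc t)) 0                              ≈⟨ toℚᵘ-ℤtoℚ (+ Λ (suc t)) ⟨
      toℚᵘ (ℕtoℚ (Λ (suc t)))                           ∎)
      where
      open ℚᵘ.≃-Reasoning
      cross : (+ suc t ℤ.* + Λ (suc t)) ℤ.* + 1 ≡ + Λ (suc t) ℤ.* + suc (t + 0)
      cross = trans (ℤ.*-identityʳ _) (trans (ℤ.*-comm (+ suc t) (+ Λ (suc t)))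
                (cong (λ j → + Λ (suc t) ℤ.* + suc j) (sym (+-identityʳ t))))

    ratio-end : ratio (suc k) ≡ ℕtoℚ m
    ratio-end = ℚ.toℚᵘ-injective
      (ℚᵘ.≃-trans (toℚᵘ-ratio k) (ℚᵘ.≃-trans (*≡* cross) (ℚᵘ.≃-sym (toℚᵘ-ℤtoℚ (+ m)))))
      where
      cross : + Λ (suc k) ℤ.* + 1 ≡ + m ℤ.* + suc k
      cross = trans (ℤ.*-identityʳ _) (trans (cong +_ (trans end (*-comm (suc k) m))) (ℤ.pos-* m (suc k)))

    ratio-mono : ∀ t → t ≤ k → ratio t ℚ.≤ ratio (suc t)
    ratio-mono zero    _   = ℤtoℚ-mono-≤ {+ 0} {+ Λ 1} (+≤+ z≤n)
    ratio-mono (suc t) t<k = ℚ.toℚᵘ-cancel-≤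
      (ℚᵘ.≤-respˡ-≃ (ℚᵘ.≃-sym (toℚᵘ-ratio t)) (ℚᵘ.≤-respʳ-≃ (ℚᵘ.≃-sym (toℚᵘ-ratio (suc t)))
        (*≤* (subst₂ ℤ._≤_ (ℤ.pos-* (Λ (suc t)) (suc (suc t))) (ℤ.pos-* (Λ (suc (suc t))) (suc t))
          (+≤+ (subst₂ _≤_ (*-comm (suc (suc t)) (Λ (suc t))) (*-comm (suc t) (Λ (suc (suc t))))
            (step (suc t) t<k)))))))

    weight : ℕ → ℚ
    weight p = ratio (suc p) ℚ.- ratio p

    weight-nonneg : ∀ p → p ≤ k → 0ℚ ℚ.≤ weight p
    weight-nonneg p p≤k =
      subst (ℚ._≤ weight p) (ℚ.+-inverseʳ (ratio p)) (ℚ.+-monoˡ-≤ (ℚ.- ratio p) (ratio-mono p p≤k))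

    ∑ℚ-weight : ∀ t → ∑ℚ t weight ≡ ratio t
    ∑ℚ-weight t = trans (∑ℚ-telescope ratio t) (ℚ.+-identityʳ (ratio t))

    weights : List (ℚ × Vec ℕ (suc k))
    weights = map (λ p → weight p , vertexVec k p) (downFrom (suc k))

    sumℚ-weights : ∀ (f : ℚ × Vec ℕ (suc k) → ℚ) →
                   sumℚ (map f weights) ≡ ∑ℚ (suc k) (λ p → f (weight p , vertexVec k p))
    sumℚ-weights f = cong sumℚ (sym (map-∘ {g = f} {f = λ p → weight p , vertexVec k p} (downFrom (suc k))))

    weights-valid : All (λ c → 0ℚ ℚ.≤ proj₁ c × IsVertex (suc k) (proj₂ c)) weights
    weights-valid = All.map⁺ (All.applyDownFrom⁺₁ id (suc k)
      (λ {p} p<k+1 → weight-nonneg p (≤-pred p<k+1) , isVertex-vertexVec (≤-pred p<k+1)))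

    mass : sumℚ (map proj₁ weights) ≡ ℕtoℚ m
    mass = trans (sumℚ-weights proj₁) (trans (∑ℚ-weight (suc k)) ratio-end)

    x : Vec ℤ (suc k)
    x = latticePoint k m Λ

    ∑ℚ-combination-weights : ∀ t → t ≤ suc k →
                             ∑ℚ t (combination weights) ≡ ∑ℚ t (λ i → ℤtoℚ (lookupOr 0ℤ x i))
    ∑ℚ-combination-weights t t≤k+1 = begin
      ∑ℚ t (combination weights)
        ≡⟨ ∑ℚ-combination-of-vertices weights (All.map proj₂ weights-valid) t t≤k+1 ⟩
      S ℚ.* sumℚ (map proj₁ weights) ℚ.+ sumℚ (map (λ c → proj₁ c ℚ.* ℕtoℚ (excess k (proj₂ c) t)) weights)
        ≡⟨ cong₂ ℚ._+_ (cong (S ℚ.*_) mass) (sumℚ-weights (λ c → proj₁ c ℚ.* ℕtoℚ (excess k (proj₂ c) t))) ⟩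
      S ℚ.* ℕtoℚ m ℚ.+ ∑ℚ (suc k) (λ p → weight p ℚ.* ℕtoℚ (excess k (vertexVec k p) t))
        ≡⟨ cong (S ℚ.* ℕtoℚ m ℚ.+_)
             (∑ℚ-cong (suc k) (λ p _ → cong (λ e → weight p ℚ.* ℕtoℚ e) (excess-vertexVec k p t t≤k+1))) ⟩
      S ℚ.* ℕtoℚ m ℚ.+ ∑ℚ (suc k) (λ p → weight p ℚ.* ℕtoℚ (jump p t))
        ≡⟨ cong (S ℚ.* ℕtoℚ m ℚ.+_)
             (trans (∑ℚ-jump weight (suc k) t t≤k+1) (trans (cong (ℕtoℚ t ℚ.*_) (∑ℚ-weight t)) (ratio-* t))) ⟩
      S ℚ.* ℕtoℚ m ℚ.+ ℕtoℚ (Λ t)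
        ≡⟨ trans (ℕtoℚ-+ (staircase k t * m) (Λ t)) (cong (ℚ._+ ℕtoℚ (Λ t)) (ℕtoℚ-* (staircase k t) m)) ⟨
      ℤtoℚ (+ (staircase k t * m + Λ t))
        ≡⟨ cong ℤtoℚ (∑ℤ-latticePoint k m Λ start t t≤k+1) ⟨
      ℤtoℚ (∑ℤ t (lookupOr 0ℤ x))
        ≡⟨ ℤtoℚ-∑ℤ t (lookupOr 0ℤ x) ⟩
      ∑ℚ t (λ i → ℤtoℚ (lookupOr 0ℤ x i)) ∎
      where
      open ≡-Reasoning
      S : ℚ
      S = ℕtoℚ (staircase k t)

  lectureHall⇒inDilate : InDilate (suc k) m (latticePoint k m Λ)
  lectureHall⇒inDilate = weights , weights-valid , mass , λ i → begin
    sumℚ (map (λ c → proj₁ c ℚ.* ℕtoℚ (lookup (proj₂ c) i)) weights)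
      ≡⟨ combination-toℕ weights i ⟨
    combination weights (toℕ i)
      ≡⟨ ∑ℚ-injective (suc k) ∑ℚ-combination-weights (toℕ i) (toℕ<n i) ⟩
    ℤtoℚ (lookupOr 0ℤ x (toℕ i))
      ≡⟨ cong ℤtoℚ (lookupOr-toℕ 0ℤ x i) ⟩
    ℤtoℚ (lookup x i) ∎
    where open ≡-Reasoning

module _ {k m} {x : Vec ℤ (suc k)} (x∈mP : InDilate (suc k) m x) where

  private
    cs : List (ℚ × Vec ℕ (suc k))
    cs = proj₁ x∈mP
    valid : All (λ c → 0ℚ ℚ.≤ proj₁ c × IsVertex (suc k) (proj₂ c)) cs
    valid = proj₁ (proj₂ x∈mP)
    mass : sumℚ (map proj₁ cs) ≡ ℕtoℚ m
    mass = proj₁ (proj₂ (proj₂ x∈mP))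
    coordinates : ∀ i → sumℚ (map (λ c → proj₁ c ℚ.* ℕtoℚ (lookup (proj₂ c) i)) cs) ≡ ℤtoℚ (lookup x i)
    coordinates = proj₂ (proj₂ (proj₂ x∈mP))

    W : ℕ → ℚ
    W t = sumℚ (map (λ c → proj₁ c ℚ.* ℕtoℚ (excess k (proj₂ c) t)) cs)

    Λℤ : ℕ → ℤ
    Λℤ t = ∑ℤ t (lookupOr 0ℤ x) ℤ.- + (staircase k t * m)

    combination≡x : ∀ i → i < suc k → combination cs i ≡ ℤtoℚ (lookupOr 0ℤ x i)
    combination≡x i i<n = begin
      combination cs i                            ≡⟨ cong (combination cs) (toℕ-fromℕ< i<n) ⟨
      combination cs (toℕ (fromℕ< i<n))           ≡⟨ combination-toℕ cs (fromℕ< i<n) ⟩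
      sumℚ (map (λ c → proj₁ c ℚ.* ℕtoℚ (lookup (proj₂ c) (fromℕ< i<n))) cs)
                                                  ≡⟨ coordinates (fromℕ< i<n) ⟩
      ℤtoℚ (lookup x (fromℕ< i<n))                ≡⟨ cong ℤtoℚ (lookupOr-fromℕ< 0ℤ x i<n) ⟨
      ℤtoℚ (lookupOr 0ℤ x i)                      ∎
      where open ≡-Reasoning

    ℤtoℚ-Λℤ : ∀ t → t ≤ suc k → ℤtoℚ (Λℤ t) ≡ W t
    ℤtoℚ-Λℤ t t≤k+1 = begin
      ℤtoℚ (Λℤ t)
        ≡⟨ ℤtoℚ-minus (∑ℤ t (lookupOr 0ℤ x)) (+ (staircase k t * m)) ⟩
      ℤtoℚ (∑ℤ t (lookupOr 0ℤ x)) ℚ.- ℕtoℚ (staircase k t * m)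
        ≡⟨ cong₂ ℚ._-_ (trans (ℤtoℚ-∑ℤ t (lookupOr 0ℤ x))
                               (∑ℚ-cong t (λ i i<t → sym (combination≡x i (<-≤-trans i<t t≤k+1)))))
                        (ℕtoℚ-* (staircase k t) m) ⟩
      ∑ℚ t (combination cs) ℚ.- S ℚ.* ℕtoℚ m
        ≡⟨ cong (ℚ._- S ℚ.* ℕtoℚ m) (∑ℚ-combination-of-vertices cs (All.map proj₂ valid) t t≤k+1) ⟩
      S ℚ.* sumℚ (map proj₁ cs) ℚ.+ W t ℚ.- S ℚ.* ℕtoℚ m
        ≡⟨ cong (λ M → S ℚ.* M ℚ.+ W t ℚ.- S ℚ.* ℕtoℚ m) mass ⟩
      S ℚ.* ℕtoℚ m ℚ.+ W t ℚ.- S ℚ.* ℕtoℚ m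
        ≡⟨ solve 2 (λ a w → a :+ w :- a := w) refl (S ℚ.* ℕtoℚ m) (W t) ⟩
      W t ∎
      where
      open ≡-Reasoning
      S : ℚ
      S = ℕtoℚ (staircase k t)

    W-nonneg : ∀ t → 0ℚ ℚ.≤ W t
    W-nonneg t = subst (ℚ._≤ W t) (sumℚ-map-0 cs) (sumℚ-map-mono-≤ (All.map
      (λ {c} (0≤λ , _) → subst (ℚ._≤ proj₁ c ℚ.* ℕtoℚ (excess k (proj₂ c) t)) (ℚ.*-zeroʳ (proj₁ c))
                               (*-monoˡ-≤-ℕtoℚ {b = excess k (proj₂ c) t} 0≤λ z≤n)) valid))

    W-step : ∀ t → t ≤ k → ℕtoℚ (suc t) ℚ.* W t ℚ.≤ ℕtoℚ t ℚ.* W (suc t)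
    W-step t t≤k = subst₂ ℚ._≤_ (sumℚ-map-*ˡ (ℕtoℚ (suc t)) _ cs) (sumℚ-map-*ˡ (ℕtoℚ t) _ cs)
      (sumℚ-map-mono-≤ (All.map (λ {c} (0≤λ , vertex) → subst₂ ℚ._≤_
        (sym (reassociate (suc t) (proj₁ c) (excess k (proj₂ c) t)))
        (sym (reassociate t (proj₁ c) (excess k (proj₂ c) (suc t))))
        (*-monoˡ-≤-ℕtoℚ 0≤λ (excess-step vertex t t≤k))) valid))
      where
      reassociate : ∀ a q b → ℕtoℚ a ℚ.* (q ℚ.* ℕtoℚ b) ≡ q ℚ.* ℕtoℚ (a * b)
      reassociate a q b = trans (solve 3 (λ a q b → a :* (q :* b) := q :* (a :* b)) refl (ℕtoℚ a) q (ℕtoℚ b))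
                                (cong (q ℚ.*_) (sym (ℕtoℚ-* a b)))

    W-end : W (suc k) ≡ ℕtoℚ (suc k * m)
    W-end = begin
      W (suc k)                                      ≡⟨ cong sumℚ (map-cong-local (All.map (λ {c} (_ , vertex) →
                                                          trans (cong (λ e → proj₁ c ℚ.* ℕtoℚ e) (excess-top vertex))
                                                                (ℚ.*-comm (proj₁ c) (ℕtoℚ (suc k)))) valid)) ⟩
      sumℚ (map (λ c → ℕtoℚ (suc k) ℚ.* proj₁ c) cs) ≡⟨ sumℚ-map-*ˡ (ℕtoℚ (suc k)) proj₁ cs ⟩
      ℕtoℚ (suc k) ℚ.* sumℚ (map proj₁ cs)           ≡⟨ cong (ℕtoℚ (suc k) ℚ.*_) mass ⟩
      ℕtoℚ (suc k) ℚ.* ℕtoℚ m                        ≡⟨ ℕtoℚ-* (suc k) m ⟨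
      ℕtoℚ (suc k * m)                               ∎
      where open ≡-Reasoning

    Λ : ℕ → ℕ
    Λ t = ℤ.∣ Λℤ t ∣

    +Λ≡Λℤ : ∀ t → t ≤ suc k → + Λ t ≡ Λℤ t
    +Λ≡Λℤ t t≤k+1 =
      ℤ.0≤i⇒+∣i∣≡i (ℤtoℚ-cancel-≤ (subst (0ℚ ℚ.≤_) (sym (ℤtoℚ-Λℤ t t≤k+1)) (W-nonneg t)))

    ℕtoℚ-Λ : ∀ t → t ≤ suc k → ℕtoℚ (Λ t) ≡ W t
    ℕtoℚ-Λ t t≤k+1 = trans (cong ℤtoℚ (+Λ≡Λℤ t t≤k+1)) (ℤtoℚ-Λℤ t t≤k+1)

    hall : LectureHall k m Λ
    hall = record
      { start = refl
      ; end   = ℤ.+-injective (ℤtoℚ-injective (trans (ℕtoℚ-Λ (suc k) ≤-refl) W-end))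
      ; step  = λ t t≤k → ℤ.drop‿+≤+ (ℤtoℚ-cancel-≤ (subst₂ ℚ._≤_
                  (sym (trans (ℕtoℚ-* (suc t) (Λ t)) (cong (ℕtoℚ (suc t) ℚ.*_) (ℕtoℚ-Λ t (m≤n⇒m≤1+n t≤k)))))
                  (sym (trans (ℕtoℚ-* t (Λ (suc t))) (cong (ℕtoℚ t ℚ.*_) (ℕtoℚ-Λ (suc t) (s≤s t≤k)))))
                  (W-step t t≤k)))
      }

    x≡latticePoint : x ≡ latticePoint k m Λ
    x≡latticePoint = lookupOr-extensional 0ℤ x (latticePoint k m Λ) (∑ℤ-injective (suc k) (λ t t≤k+1 → begin
      ∑ℤ t (lookupOr 0ℤ x)                           ≡⟨ a≡a-b+b (∑ℤ t (lookupOr 0ℤ x)) (+ (staircase k t * m)) ⟩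
      Λℤ t ℤ.+ + (staircase k t * m)                 ≡⟨ cong (ℤ._+ + (staircase k t * m)) (+Λ≡Λℤ t t≤k+1) ⟨
      + (Λ t + staircase k t * m)                    ≡⟨ cong +_ (+-comm (Λ t) (staircase k t * m)) ⟩
      + (staircase k t * m + Λ t)                    ≡⟨ ∑ℤ-latticePoint k m Λ refl t t≤k+1 ⟨
      ∑ℤ t (lookupOr 0ℤ (latticePoint k m Λ))        ∎))
      where
      open ≡-Reasoning
      a≡a-b+b : ∀ a b → a ≡ a ℤ.- b ℤ.+ b
      a≡a-b+b = ℤ-Solver.solve-∀

  inDilate⇒lectureHall : ∃ λ Λ → LectureHall k m Λ × x ≡ latticePoint k m Λ
  inDilate⇒lectureHall = Λ , hall , x≡latticePoint

*-cancelˡ-≤-+ : ∀ c {t a d} → d < suc c → suc c * t ≤ suc c * a + d → t ≤ a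
*-cancelˡ-≤-+ c {t} {a} {d} d<c+1 ct≤ca+d = ≮⇒≥ λ a<t → <-irrefl refl (begin-strict
  suc c * a + d        <⟨ +-monoʳ-< (suc c * a) d<c+1 ⟩
  suc c * a + suc c    ≡⟨ trans (*-suc (suc c) a) (+-comm (suc c) (suc c * a)) ⟨
  suc c * suc a        ≤⟨ *-monoʳ-≤ (suc c) a<t ⟩
  suc c * t            ≤⟨ ct≤ca+d ⟩
  suc c * a + d        ∎)
  where open ≤-Reasoning

head₀ : ∀ {J} → Vec ℕ J → ℕ
head₀ []      = 0
head₀ (x ∷ _) = x

-- A chain (Λ J, …, Λ 1), read with Λ 0 = 0, satisfies (t + 1) Λ t ≤ t Λ (t + 1) for all t < J.
IsChain : ∀ {J} → Vec ℕ J → Set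
IsChain []              = ⊤
IsChain {suc J} (x ∷ v) = suc J * head₀ v ≤ J * x × IsChain v

-- The chains of length J with head at most J q + r, where r < J.  Those with head exactly
-- (j + 1) q + r extend the chains of length j with head at most j q + pred r.
chains : (J q r : ℕ) → List (Vec ℕ J)
chains zero    q       r       = [] ∷ []
chains (suc j) q       (suc r) = chains (suc j) q r ++ map ((suc j * q + suc r) ∷_) (chains j q r)
chains (suc j) zero    zero    = map ((suc j * 0 + 0) ∷_) (chains j 0 0)
chains (suc j) (suc q) zero    = chains (suc j) q j ++ map ((suc j * suc q + 0) ∷_) (chains j (suc q) 0)

chain-slack : ∀ j q r → r ≤ j → ∃ λ d → d < suc j × j * (suc j * q + r) ≡ suc j * (j * q + pred r) + d
chain-slack j q zero    _           = 0 , s≤s z≤n , slack-0 j q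
  where
  slack-0 : ∀ j q → j * (suc j * q + 0) ≡ suc j * (j * q + 0) + 0
  slack-0 = solve-∀
chain-slack j q (suc s) s+1≤j with e , refl ← m≤n⇒∃[o]m+o≡n s+1≤j =
  suc e , s≤s (s≤s (m≤n+m e s)) , slack-suc s e q
  where
  slack-suc : ∀ s e q → suc (s + e) * (suc (suc (s + e)) * q + suc s) ≡ suc (suc (s + e)) * (suc (s + e) * q + s) + suc e
  slack-suc = solve-∀

∷-isChain : ∀ {j q r} {v : Vec ℕ j} → r ≤ j → IsChain v → head₀ v ≤ j * q + pred r →
            IsChain ((suc j * q + r) ∷ v)
∷-isChain {j} {q} {r} {v} r≤j chain bound with d , _ , slack ← chain-slack j q r r≤j =
  subst (suc j * head₀ v ≤_) (sym slack) (≤-trans (*-monoʳ-≤ (suc j) bound) (m≤m+n _ d)) , chain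

∷-isChain⁻ : ∀ {j q r} {v : Vec ℕ j} → r ≤ j → IsChain ((suc j * q + r) ∷ v) → head₀ v ≤ j * q + pred r
∷-isChain⁻ {j} {q} {r} {v} r≤j (step , _) with d , d<j+1 , slack ← chain-slack j q r r≤j =
  *-cancelˡ-≤-+ j d<j+1 (subst (suc j * head₀ v ≤_) slack step)

private
  extend-sound : ∀ {j q r} → r ≤ j →
    (∀ {v} → v ∈ chains j q (pred r) → IsChain v × head₀ v ≤ j * q + pred r) →
    ∀ {w} → w ∈ map ((suc j * q + r) ∷_) (chains j q (pred r)) → IsChain w × head₀ w ≤ suc j * q + r
  extend-sound r≤j sound w∈ with v , v∈ , refl ← ∈-map⁻ _ w∈ =
    ∷-isChain r≤j (proj₁ (sound v∈)) (proj₂ (sound v∈)) , ≤-refl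

  extend-complete : ∀ {j q r} → r ≤ j →
    (∀ v → IsChain v → head₀ v ≤ j * q + pred r → v ∈ chains j q (pred r)) →
    ∀ {x} (v : Vec ℕ j) → x ≡ suc j * q + r → IsChain (x ∷ v) →
    (x ∷ v) ∈ map ((suc j * q + r) ∷_) (chains j q (pred r))
  extend-complete r≤j complete v refl chain = ∈-map⁺ _ (complete v (proj₂ chain) (∷-isChain⁻ r≤j chain))

  below-[1+j][1+q] : ∀ j q → suc (suc j * q + j) ≡ suc j * suc q + 0
  below-[1+j][1+q] = solve-∀

chains-sound : ∀ J q r → r ≤ pred J → ∀ {v} → v ∈ chains J q r → IsChain v × head₀ v ≤ J * q + r
chains-sound zero    q       r       _   (here refl) = tt , z≤n
chains-sound (suc j) zero    zero    _   v∈ = extend-sound z≤n (chains-sound j 0 0 z≤n) v∈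
chains-sound (suc j) (suc q) zero    _   v∈ with ∈-++⁻ (chains (suc j) q j) v∈
... | inj₁ v∈below = let chain , bound = chains-sound (suc j) q j ≤-refl v∈below in
                     chain , ≤-trans bound (<⇒≤ (≤-reflexive (below-[1+j][1+q] j q)))
... | inj₂ v∈top   = extend-sound z≤n (chains-sound j (suc q) 0 z≤n) v∈top
chains-sound (suc j) q       (suc r) r<j v∈ with ∈-++⁻ (chains (suc j) q r) v∈
... | inj₁ v∈below = let chain , bound = chains-sound (suc j) q r (<⇒≤ r<j) v∈below in
                     chain , ≤-trans bound (+-monoʳ-≤ (suc j * q) (n≤1+n r))
... | inj₂ v∈top   = extend-sound r<j (chains-sound j q r (pred-mono-≤ r<j)) v∈top

chains-complete : ∀ J q r → r ≤ pred J → ∀ v → IsChain v → head₀ v ≤ J * q + r → v ∈ chains J q r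
chains-complete zero    q       r       _   []      _     _   = here refl
chains-complete (suc j) zero    zero    _   (x ∷ v) chain x≤0 =
  extend-complete z≤n (chains-complete j 0 0 z≤n) v (≤-antisym x≤0 (subst (_≤ x) (sym B≡0) z≤n)) chain
  where
  B≡0 : suc j * 0 + 0 ≡ 0
  B≡0 = trans (+-identityʳ (suc j * 0)) (*-zeroʳ (suc j))
chains-complete (suc j) (suc q) zero    _   (x ∷ v) chain x≤B with m≤n⇒m<n∨m≡n x≤B
... | inj₁ x<B = ∈-++⁺ˡ (chains-complete (suc j) q j ≤-refl (x ∷ v) chain
                   (≤-pred (≤-trans x<B (≤-reflexive (sym (below-[1+j][1+q] j q))))))
... | inj₂ x≡B = ∈-++⁺ʳ (chains (suc j) q j) (extend-complete z≤n (chains-complete j (suc q) 0 z≤n) v x≡B chain)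
chains-complete (suc j) q       (suc r) r<j (x ∷ v) chain x≤B with m≤n⇒m<n∨m≡n x≤B
... | inj₁ x<B = ∈-++⁺ˡ (chains-complete (suc j) q r (<⇒≤ r<j) (x ∷ v) chain
                   (≤-pred (subst (x <_) (+-suc (suc j * q) r) x<B)))
... | inj₂ x≡B = ∈-++⁺ʳ (chains (suc j) q r)
                   (extend-complete r<j (chains-complete j q r (pred-mono-≤ r<j)) v x≡B chain)

private
  below-disjoint : ∀ {j B} (xs : List (Vec ℕ (suc j))) (ys : List (Vec ℕ j)) →
                   (∀ {w} → w ∈ xs → head₀ w < B) → ∀ {w} → ¬ (w ∈ xs × w ∈ map (B ∷_) ys)
  below-disjoint xs ys below (w∈xs , w∈top) with v , _ , refl ← ∈-map⁻ _ w∈top = <-irrefl refl (below w∈xs)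

chains-unique : ∀ J q r → r ≤ pred J → Unique (chains J q r)
chains-unique zero    q       r       _   = [] ∷ []
chains-unique (suc j) q       (suc r) r<j = Unique.++⁺ (chains-unique (suc j) q r (<⇒≤ r<j))
  (Unique.map⁺ ∷-injectiveʳ (chains-unique j q r (pred-mono-≤ r<j)))
  (below-disjoint (chains (suc j) q r) (chains j q r)
    (λ {w} w∈ → subst (head₀ w <_) (sym (+-suc (suc j * q) r))
                  (s≤s (proj₂ (chains-sound (suc j) q r (<⇒≤ r<j) w∈)))))
chains-unique (suc j) zero    zero    _   = Unique.map⁺ ∷-injectiveʳ (chains-unique j 0 0 z≤n)
chains-unique (suc j) (suc q) zero    _   = Unique.++⁺ (chains-unique (suc j) q j ≤-refl)
  (Unique.map⁺ ∷-injectiveʳ (chains-unique j (suc q) 0 z≤n))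
  (below-disjoint (chains (suc j) q j) (chains j (suc q) 0)
    (λ w∈ → ≤-trans (s≤s (proj₂ (chains-sound (suc j) q j ≤-refl w∈))) (≤-reflexive (below-[1+j][1+q] j q))))

chains-length : ∀ J q r → r ≤ pred J → length (chains J q r) ≡ (2 + q) ^ r * (1 + q) ^ (J ∸ r)
chains-length zero    q       zero    _   = refl
chains-length (suc j) q       (suc r) r<j = begin
  length (chains (suc j) q r ++ map _ (chains j q r))
    ≡⟨ length-++ (chains (suc j) q r) ⟩
  length (chains (suc j) q r) + length (map _ (chains j q r))
    ≡⟨ cong₂ _+_ (chains-length (suc j) q r (<⇒≤ r<j))
                 (trans (length-map _ (chains j q r)) (chains-length j q r (pred-mono-≤ r<j))) ⟩
  (2 + q) ^ r * (1 + q) ^ (suc j ∸ r) + (2 + q) ^ r * (1 + q) ^ (j ∸ r)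
    ≡⟨ cong (λ e → (2 + q) ^ r * (1 + q) ^ e + (2 + q) ^ r * (1 + q) ^ (j ∸ r)) (+-∸-assoc 1 (<⇒≤ r<j)) ⟩
  (2 + q) ^ r * ((1 + q) * (1 + q) ^ (j ∸ r)) + (2 + q) ^ r * (1 + q) ^ (j ∸ r)
    ≡⟨ sum-of-terms q ((2 + q) ^ r) ((1 + q) ^ (j ∸ r)) ⟩
  (2 + q) * (2 + q) ^ r * (1 + q) ^ (j ∸ r) ∎
  where
  open ≡-Reasoning
  sum-of-terms : ∀ q x y → x * ((1 + q) * y) + x * y ≡ (2 + q) * x * y
  sum-of-terms = solve-∀
chains-length (suc j) zero    zero    _   = begin
  length (map _ (chains j 0 0))   ≡⟨ trans (length-map _ (chains j 0 0)) (chains-length j 0 0 z≤n) ⟩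
  1 * 1 ^ j                       ≡⟨ cong (1 *_) (trans (^-zeroˡ j) (sym (^-zeroˡ (suc j)))) ⟩
  1 * 1 ^ suc j                   ∎
  where open ≡-Reasoning
chains-length (suc j) (suc q) zero    _   = begin
  length (chains (suc j) q j ++ map _ (chains j (suc q) 0))
    ≡⟨ length-++ (chains (suc j) q j) ⟩
  length (chains (suc j) q j) + length (map _ (chains j (suc q) 0))
    ≡⟨ cong₂ _+_ (chains-length (suc j) q j ≤-refl)
                 (trans (length-map _ (chains j (suc q) 0)) (chains-length j (suc q) 0 z≤n)) ⟩
  (2 + q) ^ j * (1 + q) ^ (suc j ∸ j) + 1 * (2 + q) ^ j
    ≡⟨ cong (λ e → (2 + q) ^ j * (1 + q) ^ e + 1 * (2 + q) ^ j) (+-∸-assoc 1 (≤-refl {j})) ⟩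
  (2 + q) ^ j * (1 + q) ^ (1 + (j ∸ j)) + 1 * (2 + q) ^ j
    ≡⟨ cong (λ e → (2 + q) ^ j * (1 + q) ^ (1 + e) + 1 * (2 + q) ^ j) (n∸n≡0 j) ⟩
  (2 + q) ^ j * ((1 + q) * 1) + 1 * (2 + q) ^ j
    ≡⟨ sum-of-terms q ((2 + q) ^ j) ⟩
  1 * ((2 + q) * (2 + q) ^ j) ∎
  where
  open ≡-Reasoning
  sum-of-terms : ∀ q x → x * ((1 + q) * 1) + 1 * x ≡ 1 * ((2 + q) * x)
  sum-of-terms = solve-∀

-- The lattice points of mP

-- Λ-at v t = Λ t for a chain v = (Λ J, …, Λ 1); for t = 0 the index J ∸ t is out of range, giving 0.
Λ-at : ∀ {J} → Vec ℕ J → ℕ → ℕ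
Λ-at {J} v t = lookupOr 0 v (J ∸ t)

Λ-at-∷ : ∀ {J x t} (v : Vec ℕ J) → t ≤ J → Λ-at (x ∷ v) t ≡ Λ-at v t
Λ-at-∷ {J} {x} {t} v t≤J = cong (lookupOr 0 (x ∷ v)) (+-∸-assoc 1 t≤J)

Λ-at-head : ∀ {J x} (v : Vec ℕ J) → Λ-at (x ∷ v) (suc J) ≡ x
Λ-at-head {J} {x} v = cong (lookupOr 0 (x ∷ v)) (n∸n≡0 J)

Λ-at-0 : ∀ {J} (v : Vec ℕ J) → Λ-at v 0 ≡ 0
Λ-at-0 v = lookupOr-length 0 v

head₀≡Λ-at : ∀ {J} (v : Vec ℕ J) → head₀ v ≡ Λ-at v J
head₀≡Λ-at []      = refl
head₀≡Λ-at (x ∷ v) = sym (Λ-at-head v)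

IsChain⇒step : ∀ {J} (v : Vec ℕ J) → IsChain v → ∀ t → t < J → suc t * Λ-at v t ≤ t * Λ-at v (suc t)
IsChain⇒step (x ∷ v) (head-step , chain) t (s≤s t≤J) with m≤n⇒m<n∨m≡n t≤J
... | inj₁ t<J  = subst₂ (λ a b → suc t * a ≤ t * b) (sym (Λ-at-∷ v (<⇒≤ t<J))) (sym (Λ-at-∷ v t<J))
                    (IsChain⇒step v chain t t<J)
... | inj₂ refl = subst₂ (λ a b → suc t * a ≤ t * b) (trans (head₀≡Λ-at v) (sym (Λ-at-∷ v ≤-refl)))
                    (sym (Λ-at-head v)) head-step

Λ-at-injective : ∀ {J} (v w : Vec ℕ J) → (∀ t → t ≤ J → Λ-at v t ≡ Λ-at w t) → v ≡ w
Λ-at-injective []      []      _  = refl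
Λ-at-injective (x ∷ v) (y ∷ w) eq = cong₂ _∷_
  (trans (sym (Λ-at-head v)) (trans (eq _ ≤-refl) (Λ-at-head w)))
  (Λ-at-injective v w (λ t t≤J →
    trans (sym (Λ-at-∷ v t≤J)) (trans (eq t (m≤n⇒m≤1+n t≤J)) (Λ-at-∷ w t≤J))))

chainOf : (J : ℕ) → (ℕ → ℕ) → Vec ℕ J
chainOf zero    Λ = []
chainOf (suc J) Λ = Λ (suc J) ∷ chainOf J Λ

module _ {Λ : ℕ → ℕ} (Λ0≡0 : Λ 0 ≡ 0) where

  Λ-at-chainOf : ∀ J t → t ≤ J → Λ-at (chainOf J Λ) t ≡ Λ t
  Λ-at-chainOf zero    zero    _   = sym Λ0≡0
  Λ-at-chainOf (suc J) t       t≤J+1 with m≤n⇒m<n∨m≡n t≤J+1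
  ... | inj₁ (s≤s t≤J) = trans (Λ-at-∷ (chainOf J Λ) t≤J) (Λ-at-chainOf J t t≤J)
  ... | inj₂ refl      = Λ-at-head (chainOf J Λ)

  chainOf-isChain : ∀ J → (∀ t → t < J → suc t * Λ t ≤ t * Λ (suc t)) → IsChain (chainOf J Λ)
  chainOf-isChain zero    _    = _
  chainOf-isChain (suc J) step =
    subst (λ h → suc J * h ≤ J * Λ (suc J)) (sym (trans (head₀≡Λ-at (chainOf J Λ)) (Λ-at-chainOf J J ≤-refl)))
      (step J ≤-refl) ,
    chainOf-isChain J (λ t t<J → step t (m<n⇒m<1+n t<J))

sequenceOf : (k m : ℕ) → Vec ℕ k → ℕ → ℕ
sequenceOf k m v = Λ-at ((suc k * m) ∷ v)

chain⇒lectureHall : ∀ {k m v} → v ∈ chains k m 0 → LectureHall k m (sequenceOf k m v)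
chain⇒lectureHall {k} {m} {v} v∈ = record
  { start = Λ-at-0 ((suc k * m) ∷ v)
  ; end   = Λ-at-head v
  ; step  = λ t t≤k → IsChain⇒step ((suc k * m) ∷ v) (top-step , chain) t (s≤s t≤k)
  }
  where
  chain : IsChain v
  chain = proj₁ (chains-sound k m 0 z≤n v∈)
  top-step : suc k * head₀ v ≤ k * (suc k * m)
  top-step = ≤-trans (*-monoʳ-≤ (suc k) (proj₂ (chains-sound k m 0 z≤n v∈))) (≤-reflexive (swap k m))
    where
    swap : ∀ k m → suc k * (k * m + 0) ≡ k * (suc k * m)
    swap = solve-∀

lectureHall⇒chain : ∀ {k m Λ} → LectureHall k m Λ →
                    chainOf k Λ ∈ chains k m 0 × (∀ t → t ≤ suc k → sequenceOf k m (chainOf k Λ) t ≡ Λ t)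
lectureHall⇒chain {k} {m} {Λ} hall =
  chains-complete k m 0 z≤n (chainOf k Λ) (chainOf-isChain start k (λ t t<k → step t (<⇒≤ t<k))) top-bound ,
  values
  where
  open LectureHall hall
  top-bound : head₀ (chainOf k Λ) ≤ k * m + 0
  top-bound = subst (_≤ k * m + 0) (sym (trans (head₀≡Λ-at (chainOf k Λ)) (Λ-at-chainOf start k k ≤-refl)))
    (*-cancelˡ-≤ (suc k) (≤-trans (step k ≤-refl) (≤-reflexive (trans (cong (k *_) end) (swap k m)))))
    where
    swap : ∀ k m → k * (suc k * m) ≡ suc k * (k * m + 0)
    swap = solve-∀
  values : ∀ t → t ≤ suc k → sequenceOf k m (chainOf k Λ) t ≡ Λ t
  values t t≤k+1 with m≤n⇒m<n∨m≡n t≤k+1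
  ... | inj₁ (s≤s t≤k) = trans (Λ-at-∷ (chainOf k Λ) t≤k) (Λ-at-chainOf start k t t≤k)
  ... | inj₂ refl      = trans (Λ-at-head (chainOf k Λ)) (sym end)

latticePoint-cong : ∀ {k m Λ Λ′} → (∀ t → t ≤ suc k → Λ t ≡ Λ′ t) →
                    latticePoint k m Λ ≡ latticePoint k m Λ′
latticePoint-cong {k} {m} eq = tabulate-cong (λ i →
  cong₂ (λ a b → + ((k ∸ toℕ i) * m + a) ℤ.- + b)
        (eq (suc (toℕ i)) (toℕ<n i)) (eq (toℕ i) (<⇒≤ (toℕ<n i))))

latticePoints : (k m : ℕ) → List (Vec ℤ (suc k))
latticePoints k m = map (λ v → latticePoint k m (sequenceOf k m v)) (chains k m 0)

latticePoints-unique : ∀ k m → Unique (latticePoints k m)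
latticePoints-unique k m = Unique.map⁺ (λ {v} {w} eq → Λ-at-injective v w (λ t t≤k →
  trans (sym (Λ-at-∷ v t≤k))
    (trans (latticePoint-injective {k} {m} {sequenceOf k m v} {sequenceOf k m w}
             (Λ-at-0 ((suc k * m) ∷ v)) (Λ-at-0 ((suc k * m) ∷ w))
             eq t (m≤n⇒m≤1+n t≤k))
      (Λ-at-∷ w t≤k))))
  (chains-unique k m 0 z≤n)

∈-latticePoints⁻ : ∀ {k m x} → x ∈ latticePoints k m → InDilate (suc k) m x
∈-latticePoints⁻ x∈ with v , v∈ , refl ← ∈-map⁻ _ x∈ = lectureHall⇒inDilate (chain⇒lectureHall v∈)

lectureHall⇒∈latticePoints : ∀ {k m Λ} → LectureHall k m Λ → latticePoint k m Λ ∈ latticePoints k m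
lectureHall⇒∈latticePoints {k} {m} hall =
  subst (_∈ latticePoints k m) (latticePoint-cong (proj₂ (lectureHall⇒chain hall)))
  (∈-map⁺ (λ v → latticePoint k m (sequenceOf k m v)) (proj₁ (lectureHall⇒chain hall)))

∈-latticePoints⁺ : ∀ {k m x} → InDilate (suc k) m x → x ∈ latticePoints k m
∈-latticePoints⁺ {k} {m} {x} x∈mP =
  subst (_∈ latticePoints k m) (sym (proj₂ (proj₂ solution))) (lectureHall⇒∈latticePoints (proj₁ (proj₂ solution)))
  where
  solution : ∃ λ Λ → LectureHall k m Λ × x ≡ latticePoint k m Λ
  solution = inDilate⇒lectureHall x∈mP

length-latticePoints : ∀ k m → length (latticePoints k m) ≡ (1 + m) ^ k
length-latticePoints k m = trans (length-map _ (chains k m 0)) (trans (chains-length k m 0 z≤n) (*-identityˡ _))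

latticeCount : ∀ k m → LatticeCount (suc k) m ((1 + m) ^ k)
latticeCount k m = latticePoints k m , latticePoints-unique k m ,
  (λ x → mk⇔ ∈-latticePoints⁻ ∈-latticePoints⁺) , length-latticePoints k m

-- Worpitzky's identity

insertions : ∀ {k} → ℕ → Vec ℕ k → List (Vec ℕ (suc k))
insertions x σ = List.tabulate (λ p → insertAt σ p x)

perms : (k : ℕ) → List (Vec ℕ k)
perms zero    = [] ∷ []
perms (suc k) = concatMap (insertions (suc k)) (perms k)

toList-insertAt↭ : ∀ {n} (σ : Vec ℕ n) p x → toList (insertAt σ p x) ↭ x ∷ toList σ
toList-insertAt↭ σ       Fin.zero    x = ↭-refl
toList-insertAt↭ (y ∷ σ) (Fin.suc p) x = ↭-trans (↭-prep y (toList-insertAt↭ σ p x)) (↭-swap y x ↭-refl)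

insertAt-injective : ∀ {n} {x} (σ τ : Vec ℕ n) p q → x ∉ toList σ → x ∉ toList τ →
                     insertAt σ p x ≡ insertAt τ q x → σ ≡ τ × p ≡ q
insertAt-injective σ       τ       Fin.zero    Fin.zero    _   _   refl = refl , refl
insertAt-injective σ       (y ∷ τ) Fin.zero    (Fin.suc q) _   x∉τ eq   =
  ⊥-elim (x∉τ (here (proj₁ (∷-injective eq))))
insertAt-injective (y ∷ σ) τ       (Fin.suc p) Fin.zero    x∉σ _   eq   =
  ⊥-elim (x∉σ (here (sym (proj₁ (∷-injective eq)))))
insertAt-injective (y ∷ σ) (z ∷ τ) (Fin.suc p) (Fin.suc q) x∉σ x∉τ eq
  with refl , eq′ ← ∷-injective eq
  with refl , refl ← insertAt-injective σ τ p q (λ x∈ → x∉σ (there x∈)) (λ x∈ → x∉τ (there x∈)) eq′ =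
  refl , refl

map-suc-upTo-suc : ∀ k → map suc (upTo (suc k)) ↭ suc k ∷ map suc (upTo k)
map-suc-upTo-suc k = subst (_↭ suc k ∷ map suc (upTo k))
  (trans (sym (map-++ suc (upTo k) List.[ k ])) (cong (map suc) (upTo-∷ʳ k)))
  (↭-sym (∷↭∷ʳ (suc k) (map suc (upTo k))))

IsPerm⇒suc∉ : ∀ {k} {σ : Vec ℕ k} → IsPerm k σ → suc k ∉ toList σ
IsPerm⇒suc∉ σ↭ k+1∈σ = <-irrefl refl (proj₂ (∈-map-suc-upTo⁻ (∈-resp-↭ σ↭ k+1∈σ)))

∈-perms⁻ : ∀ k {σ} → σ ∈ perms k → IsPerm k σ
∈-perms⁻ zero    (here refl) = ↭-refl
∈-perms⁻ (suc k) w∈ with σ , σ∈ , w∈ins ← find (∈-concatMap⁻ (insertions (suc k)) {xs = perms k} w∈)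
                      with p , refl ← ∈-tabulate⁻ {f = λ p → insertAt σ p (suc k)} w∈ins =
  ↭-trans (toList-insertAt↭ σ p (suc k)) (↭-trans (↭-prep (suc k) (∈-perms⁻ k σ∈)) (↭-sym (map-suc-upTo-suc k)))

∈-perms⁺ : ∀ k (σ : Vec ℕ k) → IsPerm k σ → σ ∈ perms k
∈-perms⁺ zero    []  _  = here refl
∈-perms⁺ (suc k) w   w↭
  with p , wp≡k+1 ← ∈⇒lookup w (∈-resp-↭ (↭-sym w↭) (∈-map-suc-upTo⁺ (s≤s z≤n) ≤-refl)) =
  subst (_∈ perms (suc k)) w′≡w
    (∈-concatMap⁺ (insertions (suc k))
      (lose (∈-perms⁺ k σ σ↭) (∈-tabulate⁺ {f = λ q → insertAt σ q (suc k)} p)))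
  where
  σ : Vec ℕ k
  σ = removeAt w p
  w′≡w : insertAt σ p (suc k) ≡ w
  w′≡w = trans (cong (insertAt σ p) (sym wp≡k+1)) (insertAt-removeAt w p)
  σ↭ : IsPerm k σ
  σ↭ = drop-∷ (↭-trans (↭-sym (toList-insertAt↭ σ p (suc k)))
         (↭-trans (subst (λ v → toList v ↭ _) (sym w′≡w) w↭) (map-suc-upTo-suc k)))

perms-unique : ∀ k → Unique (perms k)
perms-unique zero    = [] ∷ []
perms-unique (suc k) = unique-insertions (perms k) (perms-unique k) (∈-perms⁻ k)
  where
  unique-insertions : ∀ σs → Unique σs → (∀ {σ} → σ ∈ σs → IsPerm k σ) →
                      Unique (concatMap (insertions (suc k)) σs)
  unique-insertions []       _          _     = []
  unique-insertions (σ ∷ σs) (σ∉ ∷ σs!) perm = Unique.++⁺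
    (Unique.tabulate⁺ (λ {p} {q} eq → proj₂ (insertAt-injective σ σ p q k+1∉σ k+1∉σ eq)))
    (unique-insertions σs σs! (λ τ∈ → perm (there τ∈)))
    disjoint
    where
    k+1∉σ : suc k ∉ toList σ
    k+1∉σ = IsPerm⇒suc∉ (perm (here refl))
    disjoint : ∀ {w} → ¬ (w ∈ insertions (suc k) σ × w ∈ concatMap (insertions (suc k)) σs)
    disjoint (w∈σ , w∈σs) with p , refl ← ∈-tabulate⁻ {f = λ p → insertAt σ p (suc k)} w∈σ
                          with τ , τ∈ , w∈τ ← find (∈-concatMap⁻ (insertions (suc k)) {xs = σs} w∈σs)
                          with q , eq ← ∈-tabulate⁻ {f = λ q → insertAt τ q (suc k)} w∈τ =
      All.lookup σ∉ τ∈ (proj₁ (insertAt-injective σ τ p q k+1∉σ (IsPerm⇒suc∉ (perm (there τ∈))) eq))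

<ᵇ-true : ∀ {a b} → a < b → (a <ᵇ b) ≡ true
<ᵇ-true a<b = Equivalence.to T-≡ (<⇒<ᵇ a<b)

<ᵇ-false : ∀ {a b} → b ≤ a → (a <ᵇ b) ≡ false
<ᵇ-false {a} {b} b≤a = ¬-not (λ a<ᵇb → <⇒≱ (<ᵇ⇒< a b (Equivalence.from T-≡ a<ᵇb)) b≤a)

descents : ∀ {k} → Vec ℕ k → ℕ
descents σ = des (toList σ)

asc : List ℕ → ℕ
asc []           = 0
asc (x ∷ [])     = 0
asc (x ∷ y ∷ ys) = (if x <ᵇ y then 1 else 0) + asc (y ∷ ys)

des+asc : ∀ (l : List ℕ) → Unique l → des l + asc l ≡ ℕ.pred (List.length l)
des+asc []           _                = refl
des+asc (x ∷ [])     _                = refl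
des+asc (x ∷ y ∷ ys) ((x≢y ∷ _) ∷ u) with <-cmp x y
... | tri< x<y _ _ rewrite <ᵇ-true x<y | <ᵇ-false (<⇒≤ x<y) =
  trans (+-suc (des (y ∷ ys)) (asc (y ∷ ys))) (cong suc (des+asc (y ∷ ys) u))
... | tri≈ _ x≡y _ = ⊥-elim (x≢y x≡y)
... | tri> _ _ y<x rewrite <ᵇ-true y<x | <ᵇ-false (<⇒≤ y<x) = cong suc (des+asc (y ∷ ys) u)

-- Inserting a new maximum x into σ leaves the number of descents unchanged at the des σ + 1
-- positions at the end of a descent or of σ, and raises it by one at the other asc σ + 1.
sum-des-insertAt : ∀ {n} x (σ : Vec ℕ (suc n)) → Unique (toList σ) → All (_< x) (toList σ) → (G : ℕ → ℕ) →
  sum (List.tabulate (λ p → G (des (toList (insertAt σ p x))))) ≡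
  suc (des (toList σ)) * G (des (toList σ)) + suc (asc (toList σ)) * G (suc (des (toList σ)))
sum-des-insertAt x (y ∷ []) _ (y<x ∷ []) G rewrite <ᵇ-true y<x | <ᵇ-false (<⇒≤ y<x) = two-terms (G 0) (G 1)
  where
  two-terms : ∀ a b → b + (a + 0) ≡ 1 * a + 1 * b
  two-terms = solve-∀
sum-des-insertAt {suc n} x (y ∷ z ∷ w) ((y≢z ∷ _) ∷ u) (y<x ∷ z<x ∷ w<x) G
  with sum-des-insertAt x (z ∷ w) u (z<x ∷ w<x) (λ j → G ((if z <ᵇ y then 1 else 0) + j))
... | ih rewrite <ᵇ-true y<x | <ᵇ-false (<⇒≤ y<x) | <ᵇ-true z<x with <-cmp y z
...   | tri≈ _ y≡z _ = ⊥-elim (y≢z y≡z)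
...   | tri< y<z _ _ rewrite <ᵇ-true y<z | <ᵇ-false (<⇒≤ y<z) =
  trans (cong (_+_ (G (suc d))) ih) (regroup d a (G d) (G (suc d)))
  where
  d a : ℕ
  d = des (z ∷ toList w)
  a = asc (z ∷ toList w)
  regroup : ∀ d a g₀ g₁ → g₁ + (suc d * g₀ + suc a * g₁) ≡ suc d * g₀ + suc (suc a) * g₁
  regroup = solve-∀
...   | tri> _ _ z<y rewrite <ᵇ-true z<y | <ᵇ-false (<⇒≤ z<y) =
  trans (swap (G (suc (suc d))) (G (suc d)) _) (trans (cong (_+_ (G (suc d))) ih) (regroup d a (G (suc d)) (G (suc (suc d)))))
  where
  d a : ℕ
  d = des (z ∷ toList w)
  a = asc (z ∷ toList w)
  swap : ∀ a b c → a + (b + c) ≡ b + (a + c)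
  swap = solve-∀
  regroup : ∀ d a g₁ g₂ → g₁ + (suc d * g₁ + suc a * g₂) ≡ suc (suc d) * g₁ + suc a * g₂
  regroup = solve-∀

module _ {A : Set} where

  sum-map-cong : ∀ (xs : List A) {f g : A → ℕ} → (∀ {a} → a ∈ xs → f a ≡ g a) →
                 sum (map f xs) ≡ sum (map g xs)
  sum-map-cong []       _  = refl
  sum-map-cong (x ∷ xs) eq = cong₂ _+_ (eq (here refl)) (sum-map-cong xs (λ a∈ → eq (there a∈)))

  sum-map-+ : ∀ (f g : A → ℕ) xs → sum (map (λ a → f a + g a) xs) ≡ sum (map f xs) + sum (map g xs)
  sum-map-+ f g []       = refl
  sum-map-+ f g (x ∷ xs) = trans (cong (_+_ (f x + g x)) (sum-map-+ f g xs)) (interchange (f x) (g x) _ _)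
    where
    interchange : ∀ a b c d → a + b + (c + d) ≡ a + c + (b + d)
    interchange = solve-∀

  sum-map-*ˡ : ∀ c (f : A → ℕ) xs → sum (map (λ a → c * f a) xs) ≡ c * sum (map f xs)
  sum-map-*ˡ c f []       = sym (*-zeroʳ c)
  sum-map-*ˡ c f (x ∷ xs) = trans (cong (_+_ (c * f x)) (sum-map-*ˡ c f xs)) (sym (*-distribˡ-+ c (f x) _))

  sum-map-concatMap : ∀ {B : Set} (h : B → ℕ) (f : A → List B) xs →
                      sum (map h (concatMap f xs)) ≡ sum (map (λ a → sum (map h (f a))) xs)
  sum-map-concatMap h f []       = refl
  sum-map-concatMap h f (x ∷ xs) = trans (cong sum (map-++ h (f x) (concatMap f xs)))
    (trans (sum-++ (map h (f x)) (map h (concatMap f xs))) (cong (_+_ (sum (map h (f x)))) (sum-map-concatMap h f xs)))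

[1+k]*nC[1+k]≡[n∸k]*nCk : ∀ n k → suc k * (n C suc k) ≡ (n ∸ k) * (n C k)
[1+k]*nC[1+k]≡[n∸k]*nCk zero    k       = trans (cong (suc k *_) (k>n⇒nCk≡0 {0} {suc k} (s≤s z≤n)))
  (trans (*-zeroʳ (suc k)) (sym (cong (_* (0 C k)) (0∸n≡0 k))))
[1+k]*nC[1+k]≡[n∸k]*nCk (suc n) zero    = trans (+-identityʳ _) (trans (nC1≡n (suc n)) (sym (*-identityʳ (suc n))))
[1+k]*nC[1+k]≡[n∸k]*nCk (suc n) (suc k) = begin
  suc (suc k) * (suc n C suc (suc k))
    ≡⟨ cong (suc (suc k) *_) (nCk+nC[k+1]≡[n+1]C[k+1] n (suc k)) ⟨
  suc (suc k) * (n C suc k + n C suc (suc k))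
    ≡⟨ *-distribˡ-+ (suc (suc k)) (n C suc k) (n C suc (suc k)) ⟩
  suc (suc k) * X + suc (suc k) * (n C suc (suc k))
    ≡⟨ cong (_+_ (suc (suc k) * X)) ([1+k]*nC[1+k]≡[n∸k]*nCk n (suc k)) ⟩
  suc (suc k) * X + (n ∸ suc k) * X
    ≡⟨ shift-one ⟩
  suc k * X + (n ∸ k) * X
    ≡⟨ cong (_+ (n ∸ k) * X) ([1+k]*nC[1+k]≡[n∸k]*nCk n k) ⟩
  (n ∸ k) * (n C k) + (n ∸ k) * X
    ≡⟨ *-distribˡ-+ (n ∸ k) (n C k) X ⟨
  (n ∸ k) * (n C k + X)
    ≡⟨ cong ((n ∸ k) *_) (nCk+nC[k+1]≡[n+1]C[k+1] n k) ⟩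
  (suc n ∸ suc k) * (suc n C suc k) ∎
  where
  open ≡-Reasoning
  X : ℕ
  X = n C suc k
  shift-one : suc (suc k) * X + (n ∸ suc k) * X ≡ suc k * X + (n ∸ k) * X
  shift-one with ≤-<-connex (suc k) n
  ... | inj₁ k<n = trans (regroup k (n ∸ suc k) X) (cong (λ e → suc k * X + e * X) (sym (+-∸-assoc 1 k<n)))
    where
    regroup : ∀ k e x → suc (suc k) * x + e * x ≡ suc k * x + suc e * x
    regroup = solve-∀
  ... | inj₂ n<k+1 = trans (cong (λ x → suc (suc k) * x + (n ∸ suc k) * x) X≡0)
    (trans (zeros (suc (suc k)) (n ∸ suc k) (suc k) (n ∸ k)) (cong (λ x → suc k * x + (n ∸ k) * x) (sym X≡0)))
    where
    X≡0 : X ≡ 0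
    X≡0 = k>n⇒nCk≡0 n<k+1
    zeros : ∀ a b c d → a * 0 + b * 0 ≡ c * 0 + d * 0
    zeros = solve-∀

insertion-identity : ∀ m K d a → suc (d + a) ≡ K →
  suc d * ((m + suc K ∸ d) C suc K) + suc a * ((m + suc K ∸ suc d) C suc K) ≡ (1 + m) * ((m + K ∸ d) C K)
insertion-identity m K d a d+a+1≡K = begin
  suc d * ((m + suc K ∸ d) C suc K) + suc a * ((m + suc K ∸ suc d) C suc K)
    ≡⟨ cong₂ (λ x y → suc d * (x C suc K) + suc a * (y C suc K)) m+K+1∸d≡N+1 m+K+1∸[d+1]≡N ⟩
  suc d * (suc N C suc K) + suc a * (N C suc K)
    ≡⟨ cong (λ x → suc d * x + suc a * (N C suc K)) (nCk+nC[k+1]≡[n+1]C[k+1] N K) ⟨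
  suc d * (N C K + N C suc K) + suc a * (N C suc K)
    ≡⟨ regroup d a (N C K) (N C suc K) ⟩
  suc d * (N C K) + suc (suc (d + a)) * (N C suc K)
    ≡⟨ cong (λ x → suc d * (N C K) + suc x * (N C suc K)) d+a+1≡K ⟩
  suc d * (N C K) + suc K * (N C suc K)
    ≡⟨ cong (_+_ (suc d * (N C K))) ([1+k]*nC[1+k]≡[n∸k]*nCk N K) ⟩
  suc d * (N C K) + (N ∸ K) * (N C K)
    ≡⟨ *-distribʳ-+ (N C K) (suc d) (N ∸ K) ⟨
  (suc d + (N ∸ K)) * (N C K)
    ≡⟨ coefficient ⟩
  (1 + m) * (N C K)
    ≡⟨ cong (λ x → (1 + m) * (x C K)) m+K∸d≡N ⟨
  (1 + m) * ((m + K ∸ d) C K) ∎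
  where
  open ≡-Reasoning
  d<K : d < K
  d<K = subst (d <_) d+a+1≡K (s≤s (m≤m+n d a))
  N : ℕ
  N = m + (K ∸ d)
  m+K∸d≡N : m + K ∸ d ≡ N
  m+K∸d≡N = +-∸-assoc m (<⇒≤ d<K)
  m+K+1∸d≡N+1 : m + suc K ∸ d ≡ suc N
  m+K+1∸d≡N+1 = trans (+-∸-assoc m (m≤n⇒m≤1+n (<⇒≤ d<K)))
                  (trans (cong (_+_ m) (+-∸-assoc 1 (<⇒≤ d<K))) (+-suc m (K ∸ d)))
  m+K+1∸[d+1]≡N : m + suc K ∸ suc d ≡ N
  m+K+1∸[d+1]≡N = trans (cong (_∸ suc d) (+-suc m K)) m+K∸d≡N
  regroup : ∀ d a x y → suc d * (x + y) + suc a * y ≡ suc d * x + suc (suc (d + a)) * y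
  regroup = solve-∀
  coefficient : (suc d + (N ∸ K)) * (N C K) ≡ (1 + m) * (N C K)
  coefficient with ≤-<-connex d m
  ... | inj₁ d≤m = cong (_* (N C K)) (cong suc (trans (cong (_+_ d) N∸K≡m∸d) (m+[n∸m]≡n d≤m)))
    where
    N∸K≡m∸d : N ∸ K ≡ m ∸ d
    N∸K≡m∸d = begin
      m + (K ∸ d) ∸ K             ≡⟨ cong (λ x → x + (K ∸ d) ∸ K) (m∸n+n≡m d≤m) ⟨
      (m ∸ d) + d + (K ∸ d) ∸ K   ≡⟨ cong (_∸ K) (+-assoc (m ∸ d) d (K ∸ d)) ⟩
      (m ∸ d) + (d + (K ∸ d)) ∸ K ≡⟨ cong (λ x → (m ∸ d) + x ∸ K) (m+[n∸m]≡n (<⇒≤ d<K)) ⟩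
      (m ∸ d) + K ∸ K             ≡⟨ m+n∸n≡m (m ∸ d) K ⟩
      m ∸ d                       ∎
  ... | inj₂ m<d = trans (cong ((suc d + (N ∸ K)) *_) NCK≡0) (trans (*-zeroʳ (suc d + (N ∸ K)))
                     (sym (trans (cong ((1 + m) *_) NCK≡0) (*-zeroʳ (1 + m)))))
    where
    NCK≡0 : N C K ≡ 0
    NCK≡0 = k>n⇒nCk≡0 (subst (N <_) (m+[n∸m]≡n (<⇒≤ d<K)) (+-monoˡ-< (K ∸ d) m<d))

sum-insertions : ∀ K m (σ : Vec ℕ K) → IsPerm K σ →
  sum (map (λ w → (m + suc K ∸ descents w) C suc K) (insertions (suc K) σ)) ≡
  (1 + m) * ((m + K ∸ descents σ) C K)
sum-insertions zero    m []  _  = trans (+-identityʳ _) (trans (nC1≡n (m + 1))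
  (trans (+-comm m 1) (sym (*-identityʳ (1 + m)))))
sum-insertions (suc n) m σ   σ↭ = begin
  sum (map (λ w → G (descents w)) (insertions (suc (suc n)) σ))
    ≡⟨ cong sum (map-tabulate (λ p → insertAt σ p (suc (suc n))) (λ w → G (descents w))) ⟩
  sum (List.tabulate (λ p → G (des (toList (insertAt σ p (suc (suc n)))))))
    ≡⟨ sum-des-insertAt (suc (suc n)) σ (IsPerm⇒Unique σ↭) below-max G ⟩
  suc d * G d + suc a * G (suc d)
    ≡⟨ insertion-identity m (suc n) d a
         (cong suc (trans (des+asc (toList σ) (IsPerm⇒Unique σ↭)) (cong ℕ.pred (length-toList σ)))) ⟩
  (1 + m) * ((m + suc n ∸ d) C suc n) ∎
  where
  open ≡-Reasoning
  G : ℕ → ℕ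
  G j = (m + suc (suc n) ∸ j) C suc (suc n)
  d a : ℕ
  d = des (toList σ)
  a = asc (toList σ)
  below-max : All.All (_< suc (suc n)) (toList σ)
  below-max = All.tabulate (λ y∈σ → s≤s (proj₂ (∈-map-suc-upTo⁻ (∈-resp-↭ σ↭ y∈σ))))

worpitzky : ∀ k m → sum (map (λ σ → (m + k ∸ descents σ) C k) (perms k)) ≡ (1 + m) ^ k
worpitzky zero    m = refl
worpitzky (suc k) m = begin
  sum (map h (concatMap (insertions (suc k)) (perms k)))
    ≡⟨ sum-map-concatMap h (insertions (suc k)) (perms k) ⟩
  sum (map (λ σ → sum (map h (insertions (suc k) σ))) (perms k))
    ≡⟨ sum-map-cong (perms k) (λ σ∈ → sum-insertions k m _ (∈-perms⁻ k σ∈)) ⟩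
  sum (map (λ σ → (1 + m) * g σ) (perms k))
    ≡⟨ sum-map-*ˡ (1 + m) g (perms k) ⟩
  (1 + m) * sum (map g (perms k))
    ≡⟨ cong ((1 + m) *_) (worpitzky k m) ⟩
  (1 + m) ^ suc k ∎
  where
  open ≡-Reasoning
  h : Vec ℕ (suc k) → ℕ
  h w = (m + suc k ∸ descents w) C suc k
  g : Vec ℕ k → ℕ
  g σ = (m + k ∸ descents σ) C k

δ : ℕ → ℕ → ℕ
δ d j = if d ≡ᵇ j then 1 else 0

sum-applyUpTo-0 : ∀ N → sum (applyUpTo (λ _ → 0) N) ≡ 0
sum-applyUpTo-0 zero    = refl
sum-applyUpTo-0 (suc N) = sum-applyUpTo-0 N

sum-applyUpTo-δ : ∀ N (g : ℕ → ℕ) d → d < N → sum (applyUpTo (λ j → δ d j * g j) N) ≡ g d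
sum-applyUpTo-δ (suc N) g zero    _         =
  trans (cong (_+_ (1 * g 0)) (sum-applyUpTo-0 N)) (trans (+-identityʳ _) (*-identityˡ (g 0)))
sum-applyUpTo-δ (suc N) g (suc d) (s≤s d<N) = sum-applyUpTo-δ N (λ j → g (suc j)) d d<N

module _ {A : Set} (d : A → ℕ) where

  fibre : ℕ → List A → ℕ
  fibre j xs = length (filter (λ a → d a ≟ j) xs)

  fibre-∷ : ∀ a xs j → fibre j (a ∷ xs) ≡ δ (d a) j + fibre j xs
  fibre-∷ a xs j with d a ≡ᵇ j
  ... | true  = refl
  ... | false = refl

  sum-fibres : ∀ (g : ℕ → ℕ) N xs → All (λ a → d a < N) xs →
               sum (map (λ j → fibre j xs * g j) (upTo N)) ≡ sum (map (λ a → g (d a)) xs)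
  sum-fibres g N []       []           = trans (cong sum (map-upTo _ N)) (sum-applyUpTo-0 N)
  sum-fibres g N (a ∷ xs) (da<N ∷ ds) = begin
    sum (map (λ j → fibre j (a ∷ xs) * g j) (upTo N))
      ≡⟨ cong sum (map-cong (λ j → trans (cong (_* g j) (fibre-∷ a xs j)) (*-distribʳ-+ (g j) (δ (d a) j) (fibre j xs)))
                            (upTo N)) ⟩
    sum (map (λ j → δ (d a) j * g j + fibre j xs * g j) (upTo N))
      ≡⟨ sum-map-+ (λ j → δ (d a) j * g j) (λ j → fibre j xs * g j) (upTo N) ⟩
    sum (map (λ j → δ (d a) j * g j) (upTo N)) + sum (map (λ j → fibre j xs * g j) (upTo N))
      ≡⟨ cong₂ _+_ (trans (cong sum (map-upTo _ N)) (sum-applyUpTo-δ N g (d a) da<N)) (sum-fibres g N xs ds) ⟩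
    g (d a) + sum (map (λ a → g (d a)) xs) ∎
    where open ≡-Reasoning

EulerianCount⇒fibre : ∀ {k j e} → EulerianCount k j e → e ≡ fibre descents j (perms k)
EulerianCount⇒fibre {k} {j} (σs , σs! , σs⇔ , length≡e) = trans (sym length≡e)
  (↭-length (↭-from-same-elements σs! (Unique.filter⁺ (λ σ → descents σ ≟ j) (perms-unique k))
    (λ σ∈ → let σ↭ , desσ≡j = Equivalence.to (σs⇔ _) σ∈ in
            ∈-filter⁺ (λ σ → descents σ ≟ j) (∈-perms⁺ k _ σ↭) desσ≡j)
    (λ σ∈ → let σ∈perms , desσ≡j = ∈-filter⁻ (λ σ → descents σ ≟ j) σ∈ in
            Equivalence.from (σs⇔ _) (∈-perms⁻ k σ∈perms , desσ≡j))))

descents<suc : ∀ {k} {σ : Vec ℕ k} → IsPerm k σ → descents σ < suc k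
descents<suc {k} {σ} σ↭ = s≤s (begin
  des (toList σ)                     ≤⟨ m≤m+n (des (toList σ)) (asc (toList σ)) ⟩
  des (toList σ) + asc (toList σ)    ≡⟨ des+asc (toList σ) (IsPerm⇒Unique σ↭) ⟩
  ℕ.pred (length (toList σ))         ≡⟨ cong ℕ.pred (length-toList σ) ⟩
  ℕ.pred k                           ≤⟨ pred[n]≤n ⟩
  k                                  ∎)
  where open ≤-Reasoning

eulerian-worpitzky : ∀ k m (E : ℕ → ℕ) → (∀ j → EulerianCount k j (E j)) →
                     sum (map (λ j → E j * ((m + k ∸ j) C k)) (upTo (suc k))) ≡ (1 + m) ^ k
eulerian-worpitzky k m E eulerian = begin
  sum (map (λ j → E j * g j) (upTo (suc k)))
    ≡⟨ cong sum (map-cong (λ j → cong (_* g j) (EulerianCount⇒fibre (eulerian j))) (upTo (suc k))) ⟩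
  sum (map (λ j → fibre descents j (perms k) * g j) (upTo (suc k)))
    ≡⟨ sum-fibres descents g (suc k) (perms k) (All.tabulate (λ σ∈ → descents<suc (∈-perms⁻ k σ∈))) ⟩
  sum (map (λ σ → g (descents σ)) (perms k))
    ≡⟨ worpitzky k m ⟩
  (1 + m) ^ k ∎
  where
  open ≡-Reasoning
  g : ℕ → ℕ
  g j = (m + k ∸ j) C k

proposition3p20 : (k : ℕ) →
    ((m : ℕ) → LatticeCount (suc k) m ((1 + m) ^ k))
    × ((E : ℕ → ℕ) → ((j : ℕ) → EulerianCount k j (E j)) →
       (m : ℕ) → LatticeCount (suc k) m
         (sum (map (λ j → E j * ((m + k ∸ j) C k)) (upTo (suc k)))))
proposition3p20 k = latticeCount k , λ E eulerian m →
  subst (LatticeCount (suc k) m) (sym (eulerian-worpitzky k m E eulerian)) (latticeCount k m)
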